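{- Let $P$ be a naturally labeled poset on $[n]=\{1,\dots,n\}$ (i.e. $i<_P j$ implies $i<j$). Let $G=\overline{\mathcal{H}(P)}$ be the directed transitive closure of the Hasse diagram of $P$, i.e. the graph on $[n]$ with an edge $(i,j)$, $i<j$, whenever $i<_P j$. For an ordered pair $(L,R)$ with $L\sqcup R=[n]$ let $G_{L,R}$ be the graph on the vertex set $[n]$ with edge set $\{(i,j)\in E(G)\mid i\in L,\ j\in R,\ i<j\}$. Then for every such $(L,R)$ for which $G_{L,R}$ is connected, $G_{L,R}$ is the Hasse diagram $\mathcal{H}(P_{L,R})$ of a naturally labeled poset $P_{L,R}$ on $[n]$, and $$\Psi_P(\mathbf{x})=\sum_{L,R}\Psi_{P_{L,R}}(\mathbf{x}),$$ where the sum runs over all ordered pairs $(L,R)$ with $L\sqcup R=[n]$ such that $G_{L,R}$ is connected.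
   Context: For a poset $Q$ on $[n]$ and variables $\mathbf{x}=(x_1,\dots,x_n)$, Greene's rational function is $\Psi_Q(\mathbf{x})=\sum_{w\in\mathcal{L}(Q)}\frac{1}{(x_{w_1}-x_{w_2})(x_{w_2}-x_{w_3})\cdots(x_{w_{n-1}}-x_{w_n})}$, where $\mathcal{L}(Q)$ is the set of linear extensions $w=(w_1,\dots,w_n)$ of $Q$ (orderings of $[n]$ such that $w_a<_Q w_b$ implies $a<b$). The Hasse diagram $\mathcal{H}(Q)$ is the graph on $[n]$ with edges $(i,j)$ for the cover relations $i\lessdot_Q j$. -}

module Defs where

open import Data.Nat using (ℕ; zero; suc)
open import Data.Bool using (Bool; true; false; not; _∧_; if_then_else_)
open import Data.Fin using (Fin; _<_)
open import Data.List using (List; []; _∷_; map; concatMap; filter; foldr; allFin; _++_)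
open import Data.Vec using (Vec; lookup)
open import Data.Product using (_×_)
open import Data.Rational using (ℚ; 0ℚ; 1ℚ; _+_; _-_; _*_; 1/_; ≢-nonZero)
open import Data.Rational.Properties using (_≟_)
open import Relation.Nullary using (yes; no)
open import Relation.Binary.PropositionalEquality using (_≡_)

record NLPoset (n : ℕ) : Set where
  field
    lt      : Fin n → Fin n → Bool
    irrefl  : ∀ i → lt i i ≡ false
    trans   : ∀ i j k → lt i j ≡ true → lt j k ≡ true → lt i k ≡ true
    natural : ∀ i j → lt i j ≡ true → i < j
open NLPoset public

Cover : ∀ {n} → NLPoset n → Fin n → Fin n → Set
Cover Q i j = (lt Q i j ≡ true) × (∀ k → lt Q i k ≡ true → lt Q k j ≡ true → Data.Empty.⊥)
  where import Data.Empty

insertions : ∀ {A : Set} → A → List A → List (List A)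
insertions x []       = (x ∷ []) ∷ []
insertions x (y ∷ ys) = (x ∷ y ∷ ys) ∷ map (y ∷_) (insertions x ys)

perms : ∀ {A : Set} → List A → List (List A)
perms []       = [] ∷ []
perms (x ∷ xs) = concatMap (insertions x) (perms xs)

allB : ∀ {A : Set} → (A → Bool) → List A → Bool
allB p []       = true
allB p (y ∷ ys) = p y ∧ allB p ys

isLinExt : ∀ {n} → NLPoset n → List (Fin n) → Bool
isLinExt Q []       = true
isLinExt Q (h ∷ ws) = allB (λ y → not (lt Q y h)) ws ∧ isLinExt Q ws

linExts : ∀ {n} → NLPoset n → List (List (Fin n))
linExts {n} Q = filter (λ w → isLinExt Q w Data.Bool.≟ true) (perms (allFin n))
  where import Data.Bool

-- total inverse on ℚ (agrees with 1/q whenever q ≠ 0, which is always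
-- the case below since x will have pairwise distinct coordinates)
inv : ℚ → ℚ
inv q with q ≟ 0ℚ
... | yes _  = 0ℚ
... | no q≢0 = 1/_ q {{≢-nonZero q≢0}}

chainProd : ∀ {n} → (Fin n → ℚ) → List (Fin n) → ℚ
chainProd x []            = 1ℚ
chainProd x (a ∷ [])      = 1ℚ
chainProd x (a ∷ b ∷ ws)  = (x a - x b) * chainProd x (b ∷ ws)

sumℚ : List ℚ → ℚ
sumℚ = foldr _+_ 0ℚ

Ψ : ∀ {n} → NLPoset n → (Fin n → ℚ) → ℚ
Ψ Q x = sumℚ (map (λ w → inv (chainProd x w)) (linExts Q))

-- Ordered pairs (L,R) with L ⊔ R = [n] are encoded by s : Vec Bool n,
-- with i ∈ L iff lookup s i ≡ true (and i ∈ R iff lookup s i ≡ false).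

GEdge : ∀ {n} → NLPoset n → Vec Bool n → Fin n → Fin n → Set
GEdge P s i j = (lt P i j ≡ true) × (lookup s i ≡ true) × (lookup s j ≡ false) × (i < j)

data Reach {n : ℕ} (E : Fin n → Fin n → Set) (u : Fin n) : Fin n → Set where
  here  : Reach E u u
  fwd   : ∀ {v w} → Reach E u v → E v w → Reach E u w
  bwd   : ∀ {v w} → Reach E u v → E w v → Reach E u w

Connected : ∀ {n} → (Fin n → Fin n → Set) → Set
Connected {n} E = ∀ (u v : Fin n) → Reach E u v

module Submission where

-- Expand the indicator of "w is a linear extension of Q" by inclusion–exclusion
-- over the sets A of relations inverted by w.  Summed over all (L , R), the
-- term of A gets the weight N(A) = #{(L , R) | A ⊆ L × R}; for P itself, the
-- transitivity of the inversions of w cuts the sum down to the bipartite A.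
-- The two weights agree when A touches every vertex.  If A misses a vertex v,
-- the permutations inverting A are closed under moving v, and Greene's summand
-- sums to zero over the shuffles of two nonempty words, so A contributes
-- nothing (v needs a companion, whence n ≥ 2).  The same shuffle identity makes
-- Ψ vanish on each disconnected P_{L,R}, which leaves the connected (L , R).

open import Defs
import Algebra.Properties.Group
open import Data.Bool using (Bool; true; false; if_then_else_; not; _∧_)
import Data.Bool as Bool
open import Data.Bool.Properties using (∧-conicalˡ; ∧-conicalʳ)
open import Data.Empty using (⊥; ⊥-elim)
open import Data.Fin using (Fin)
import Data.Fin as Fin
import Data.Fin.Properties as FinP
open import Data.Fin.Subset using (Subset; ⁅_⁆; _∪_; _⊃_)
  renaming (_∈_ to _∈ˢ_; _∉_ to _∉ˢ_; _⊂_ to _⊂ˢ_)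
open import Data.Fin.Subset.Induction using (⊃-wellFounded)
open import Data.Fin.Subset.Properties using () renaming (_∈?_ to _∈ˢ?_)
import Data.Fin.Subset.Properties as SubsetP
open import Data.List using (List; []; _∷_; _++_; map; filter; concatMap; allFin; tabulate; cartesianProductWith)
open import Data.List.Membership.Propositional using (_∈_; _∉_; find)
import Data.List.Membership.DecPropositional as DecMembership
open import Data.List.Membership.Propositional.Properties
  using (∈-++⁺ʳ; ∈-filter⁺; ∈-filter⁻; ∈-allFin; ∈-map⁻)
open import Data.List.Membership.Propositional.Properties using (∈-cartesianProductWith⁺; ∈-cartesianProductWith⁻)
open import Data.List.Properties using (filter-accept; filter-reject)
open import Data.List.Relation.Binary.Equality.Propositional using (≋-refl)
open import Data.List.Relation.Binary.Permutation.Propositional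
  using (_↭_; ↭-refl; ↭-prep; ↭-swap; ↭-trans; ↭-sym; ↭⇒↭ₛ)
open import Data.List.Relation.Binary.Permutation.Propositional.Properties using (shift; ++⁺; All-resp-↭; ∈-resp-↭)
import Data.List.Relation.Binary.Permutation.Setoid.Properties as PermSetoid
open import Data.List.Relation.Ternary.Interleaving.Propositional
  using (Interleaving; []; left; right; consˡ; consʳ; toPermutation)
open import Data.List.Relation.Ternary.Interleaving.Propositional.Properties using (++-linear; filter⁺)
open import Data.List.Relation.Unary.All as All using (All; []; _∷_; all?)
open import Data.List.Relation.Unary.All.Properties using (all-filter; ¬Any⇒All¬)
import Data.List.Relation.Unary.All.Properties as AllP
open import Data.List.Relation.Unary.AllPairs using (AllPairs; []; _∷_)
import Data.List.Relation.Unary.AllPairs.Properties as AllPairsP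
open import Data.List.Relation.Unary.Any as Any using (Any; here; there)
open import Data.List.Relation.Unary.Unique.Propositional using (Unique)
open import Data.List.Relation.Unary.Unique.Propositional.Properties using (allFin⁺)
import Data.List.Relation.Unary.Unique.Propositional.Properties as UniqueP
open import Data.Nat using (ℕ; _≤_; zero; suc; z<s; s<s; s≤s)
import Data.Nat.Properties as NatP
open import Data.Product using (Σ; ∃; _×_; _,_; proj₁; proj₂)
import Data.Product as Product
open import Data.Product.Function.NonDependent.Propositional using (_×-⇔_)
open import Data.Rational using (ℚ; 0ℚ; 1ℚ; _+_; _*_; _-_; -_; ≢-nonZero)
import Data.Rational.Properties as ℚ
open import Data.Rational.Solver using (module +-*-Solver)
open import Data.Sum as Sum using (_⊎_; inj₁; inj₂; [_,_])
open import Data.Vec using (Vec; lookup)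
import Data.Vec as Vec
import Data.Vec.Properties as VecP
open import Function.Base using (_∘_; id)
open import Function.Bundles using (_⇔_; Equivalence; mk⇔)
import Function.Properties.Equivalence as Eqv
open import Induction.WellFounded using (Acc; acc)
open import Relation.Binary.Definitions using (DecidableEquality)
open import Relation.Binary.PropositionalEquality using (_≡_; _≢_; refl; sym; cong; cong₂; module ≡-Reasoning)
import Relation.Binary.PropositionalEquality as ≡
open import Relation.Nullary using (Dec; yes; no; does; contradiction; _×-dec_; _⊎-dec_; ¬_; ¬?; map′)
open import Relation.Nullary.Decidable using (dec-true; dec-false)
open import Relation.Unary using (Decidable)

open +-*-Solver using (solve; _:=_; _:+_; _:*_; _:-_; :-_; con)
open Algebra.Properties.Group ℚ.+-0-group using (x∙y⁻¹≈ε⇒x≈y)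

private
  variable
    A B C : Set

𝟙 : ∀ {p} {P : Set p} → Dec P → ℚ
𝟙 P? = if does P? then 1ℚ else 0ℚ

𝟙-cong : ∀ {p q} {P : Set p} {Q : Set q} (P? : Dec P) (Q? : Dec Q) → P ⇔ Q → 𝟙 P? ≡ 𝟙 Q?
𝟙-cong (yes _) (yes _) _   = refl
𝟙-cong (yes p) (no ¬q) P⇔Q = contradiction (Equivalence.to P⇔Q p) ¬q
𝟙-cong (no ¬p) (yes q) P⇔Q = contradiction (Equivalence.from P⇔Q q) ¬p
𝟙-cong (no _)  (no _)  _   = refl

𝟙-yes : ∀ {p} {P : Set p} (P? : Dec P) → P → 𝟙 P? ≡ 1ℚ
𝟙-yes (yes _) _ = refl
𝟙-yes (no ¬p) p = contradiction p ¬p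

𝟙-no : ∀ {p} {P : Set p} (P? : Dec P) → ¬ P → 𝟙 P? ≡ 0ℚ
𝟙-no (yes p) ¬p = contradiction p ¬p
𝟙-no (no _)  _  = refl

𝟙-× : ∀ {p q} {P : Set p} {Q : Set q} (P? : Dec P) (Q? : Dec Q) → 𝟙 (P? ×-dec Q?) ≡ 𝟙 P? * 𝟙 Q?
𝟙-× (yes _) (yes _) = refl
𝟙-× (yes _) (no _)  = refl
𝟙-× (no _)  Q?      = sym (ℚ.*-zeroˡ (𝟙 Q?))

¬-cong : ∀ {p q} {P : Set p} {Q : Set q} → P ⇔ Q → (¬ P) ⇔ (¬ Q)
¬-cong P⇔Q = mk⇔ (_∘ Equivalence.from P⇔Q) (_∘ Equivalence.to P⇔Q)

All-cong : ∀ {a p q} {A : Set a} {P : A → Set p} {Q : A → Set q} {xs} → (∀ x → P x ⇔ Q x) → All P xs ⇔ All Q xs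
All-cong P⇔Q = mk⇔ (All.map (Equivalence.to (P⇔Q _))) (All.map (Equivalence.from (P⇔Q _)))

∧-⇔ : ∀ {a b} → a ∧ b ≡ true ⇔ (a ≡ true × b ≡ true)
∧-⇔ {a} {b} = mk⇔ (λ a∧b → ∧-conicalˡ a b a∧b , ∧-conicalʳ a b a∧b) (λ { (refl , refl) → refl })

not-⇔ : ∀ {b} → not b ≡ true ⇔ b ≡ false
not-⇔ {false} = mk⇔ (λ _ → refl) (λ _ → refl)
not-⇔ {true}  = mk⇔ (λ ()) (λ ())

allB-⇔ : ∀ (p : A → Bool) xs → allB p xs ≡ true ⇔ All (λ y → p y ≡ true) xs
allB-⇔ p []       = mk⇔ (λ _ → []) (λ _ → refl)
allB-⇔ p (y ∷ ys) = mk⇔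
  (λ all → ∧-conicalˡ (p y) _ all ∷ Equivalence.to (allB-⇔ p ys) (∧-conicalʳ (p y) _ all))
  (λ { (py ∷ pys) → cong₂ _∧_ py (Equivalence.from (allB-⇔ p ys) pys) })

inv-inverseʳ : ∀ q → q ≢ 0ℚ → q * inv q ≡ 1ℚ
inv-inverseʳ q q≢0 with q ℚ.≟ 0ℚ
... | yes q≡0 = contradiction q≡0 q≢0
... | no  q≢0 = ℚ.*-inverseʳ q {{≢-nonZero q≢0}}

inv-unique : ∀ q r → q ≢ 0ℚ → q * r ≡ 1ℚ → inv q ≡ r
inv-unique q r q≢0 qr≡1 = begin
  inv q             ≡⟨ solve 3 (λ q i r → i := (q :* i) :* r :- i :* (q :* r :- con 1ℚ)) refl q (inv q) r ⟩
  q * inv q * r - inv q * (q * r - 1ℚ)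
                    ≡⟨ cong₂ (λ a b → a * r - inv q * (b - 1ℚ)) (inv-inverseʳ q q≢0) qr≡1 ⟩
  1ℚ * r - inv q * (1ℚ - 1ℚ)
                    ≡⟨ solve 2 (λ r i → con 1ℚ :* r :- i :* (con 1ℚ :- con 1ℚ) := r) refl r (inv q) ⟩
  r                 ∎
  where open ≡-Reasoning

*-≢0 : ∀ p q → p ≢ 0ℚ → q ≢ 0ℚ → p * q ≢ 0ℚ
*-≢0 p q p≢0 q≢0 pq≡0 = q≢0 (begin
  q
    ≡⟨ solve 3 (λ p i q → q := i :* (p :* q) :+ q :* (con 1ℚ :- p :* i)) refl p (inv p) q ⟩
  inv p * (p * q) + q * (1ℚ - p * inv p)
    ≡⟨ cong₂ (λ a b → inv p * a + q * (1ℚ - b)) pq≡0 (inv-inverseʳ p p≢0) ⟩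
  inv p * 0ℚ + q * (1ℚ - 1ℚ)
    ≡⟨ solve 2 (λ i q → i :* con 0ℚ :+ q :* (con 1ℚ :- con 1ℚ) := con 0ℚ) refl (inv p) q ⟩
  0ℚ ∎)
  where open ≡-Reasoning

inv-* : ∀ p q → inv (p * q) ≡ inv p * inv q
inv-* p q = cases (p ℚ.≟ 0ℚ) (q ℚ.≟ 0ℚ)
  where
  open ≡-Reasoning
  cases : Dec (p ≡ 0ℚ) → Dec (q ≡ 0ℚ) → inv (p * q) ≡ inv p * inv q
  cases (yes refl) _          = ≡.trans (cong inv (ℚ.*-zeroˡ q)) (sym (ℚ.*-zeroˡ (inv q)))
  cases (no _)     (yes refl) = ≡.trans (cong inv (ℚ.*-zeroʳ p)) (sym (ℚ.*-zeroʳ (inv p)))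
  cases (no p≢0)   (no q≢0)   = inv-unique (p * q) (inv p * inv q) (*-≢0 p q p≢0 q≢0) (begin
    p * q * (inv p * inv q)
      ≡⟨ solve 4 (λ p q i j → p :* q :* (i :* j) := (p :* i) :* (q :* j)) refl p q (inv p) (inv q) ⟩
    (p * inv p) * (q * inv q)
      ≡⟨ cong₂ _*_ (inv-inverseʳ p p≢0) (inv-inverseʳ q q≢0) ⟩
    1ℚ ∎)

inv-neg : ∀ q → inv (- q) ≡ - inv q
inv-neg q = cases (q ℚ.≟ 0ℚ)
  where
  cases : Dec (q ≡ 0ℚ) → inv (- q) ≡ - inv q
  cases (yes refl) = refl
  cases (no q≢0)   = inv-unique (- q) (- inv q) (q≢0 ∘ ℚ.neg-injective)
    (≡.trans (solve 2 (λ q i → (:- q) :* (:- i) := q :* i) refl q (inv q)) (inv-inverseʳ q q≢0))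

inv-sub-swap : ∀ a b → inv (b - a) ≡ - inv (a - b)
inv-sub-swap a b = ≡.trans (cong inv (solve 2 (λ a b → b :- a := :- (a :- b)) refl a b)) (inv-neg (a - b))

sub-≢0 : ∀ {a b} → a ≢ b → a - b ≢ 0ℚ
sub-≢0 {a} {b} a≢b a-b≡0 = a≢b (x∙y⁻¹≈ε⇒x≈y a b a-b≡0)

-- With α = 1/(c-a), β = 1/(c-b), ρ = 1/(a-b), the identity α ρ - β ρ = α β
-- follows from α = α (c-b) β and β = β (c-a) α.
partial-fractions : ∀ {a b c} → a ≢ b → c ≢ a → c ≢ b →
  inv (c - a) * inv (a - b) + inv (c - b) * inv (b - a) ≡ inv (c - a) * inv (c - b)
partial-fractions {a} {b} {c} a≢b c≢a c≢b = begin
  α * ρ + β * inv (b - a)                  ≡⟨ cong (λ t → α * ρ + β * t) (inv-sub-swap a b) ⟩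
  α * ρ + β * (- ρ)                        ≡⟨ cong₂ (λ s t → s * ρ + t * (- ρ)) (sym α≡) (sym β≡) ⟩
  α * ((c - b) * β) * ρ + β * ((c - a) * α) * (- ρ)
    ≡⟨ solve 6 (λ a b c α β ρ → α :* ((c :- b) :* β) :* ρ :+ β :* ((c :- a) :* α) :* (:- ρ)
                               := ((a :- b) :* ρ) :* (α :* β)) refl a b c α β ρ ⟩
  ((a - b) * ρ) * (α * β)                  ≡⟨ cong (_* (α * β)) (inv-inverseʳ (a - b) (sub-≢0 a≢b)) ⟩
  1ℚ * (α * β)                             ≡⟨ ℚ.*-identityˡ (α * β) ⟩
  α * β                                    ∎
  where
  open ≡-Reasoning
  α = inv (c - a)
  β = inv (c - b)
  ρ = inv (a - b)
  α≡ : α * ((c - b) * β) ≡ α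
  α≡ = ≡.trans (cong (α *_) (inv-inverseʳ (c - b) (sub-≢0 c≢b))) (ℚ.*-identityʳ α)
  β≡ : β * ((c - a) * α) ≡ β
  β≡ = ≡.trans (cong (β *_) (inv-inverseʳ (c - a) (sub-≢0 c≢a))) (ℚ.*-identityʳ β)

Functional : Set → Set
Functional B = (B → ℚ) → ℚ

record IsLinear {B : Set} (Φ : Functional B) : Set where
  field
    resp   : ∀ {f g} → (∀ b → f b ≡ g b) → Φ f ≡ Φ g
    +-homo : ∀ f g → Φ (λ b → f b + g b) ≡ Φ f + Φ g
    *-homo : ∀ c f → Φ (λ b → c * f b) ≡ c * Φ f

  0-homo : Φ (λ _ → 0ℚ) ≡ 0ℚ
  0-homo = begin
    Φ (λ _ → 0ℚ)        ≡⟨ resp (λ _ → sym (ℚ.*-zeroˡ 0ℚ)) ⟩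
    Φ (λ _ → 0ℚ * 0ℚ)   ≡⟨ *-homo 0ℚ (λ _ → 0ℚ) ⟩
    0ℚ * Φ (λ _ → 0ℚ)   ≡⟨ ℚ.*-zeroˡ (Φ (λ _ → 0ℚ)) ⟩
    0ℚ                  ∎
    where open ≡-Reasoning

  vanishes : ∀ {f} → (∀ b → f b ≡ 0ℚ) → Φ f ≡ 0ℚ
  vanishes f≡0 = ≡.trans (resp f≡0) 0-homo

  sub-homo : ∀ f g → Φ (λ b → f b - g b) ≡ Φ f - Φ g
  sub-homo f g = begin
    Φ (λ b → f b - g b)
      ≡⟨ resp (λ b → solve 2 (λ x y → x :- y := x :+ (:- con 1ℚ) :* y) refl (f b) (g b)) ⟩
    Φ (λ b → f b + (- 1ℚ) * g b)
      ≡⟨ +-homo f (λ b → (- 1ℚ) * g b) ⟩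
    Φ f + Φ (λ b → (- 1ℚ) * g b)
      ≡⟨ cong (Φ f +_) (*-homo (- 1ℚ) g) ⟩
    Φ f + (- 1ℚ) * Φ g
      ≡⟨ solve 2 (λ x y → x :+ (:- con 1ℚ) :* y := x :- y) refl (Φ f) (Φ g) ⟩
    Φ f - Φ g ∎
    where open ≡-Reasoning

  *-homoʳ : ∀ f c → Φ (λ b → f b * c) ≡ Φ f * c
  *-homoʳ f c = ≡.trans (resp (λ b → ℚ.*-comm (f b) c)) (≡.trans (*-homo c f) (ℚ.*-comm c (Φ f)))

eval-linear : (b : B) → IsLinear (λ (g : B → ℚ) → g b)
eval-linear b = record { resp = λ f≗g → f≗g b ; +-homo = λ _ _ → refl ; *-homo = λ _ _ → refl }

∘-linear : ∀ {Φ : Functional C} (h : C → B) → IsLinear Φ → IsLinear (λ (g : B → ℚ) → Φ (g ∘ h))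
∘-linear h Φ-lin = record
  { resp   = λ f≗g → resp (f≗g ∘ h)
  ; +-homo = λ f g → +-homo (f ∘ h) (g ∘ h)
  ; *-homo = λ c f → *-homo c (f ∘ h)
  }
  where open IsLinear Φ-lin

+-linear : ∀ {Φ Ψ : Functional B} → IsLinear Φ → IsLinear Ψ → IsLinear (λ g → Φ g + Ψ g)
+-linear {Φ = Φ} {Ψ = Ψ} Φ-lin Ψ-lin = record
  { resp   = λ f≗g → cong₂ _+_ (Φ.resp f≗g) (Ψ.resp f≗g)
  ; +-homo = λ f g → ≡.trans (cong₂ _+_ (Φ.+-homo f g) (Ψ.+-homo f g))
      (solve 4 (λ a b c d → (a :+ b) :+ (c :+ d) := (a :+ c) :+ (b :+ d)) refl (Φ f) (Φ g) (Ψ f) (Ψ g))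
  ; *-homo = λ c f → ≡.trans (cong₂ _+_ (Φ.*-homo c f) (Ψ.*-homo c f)) (sym (ℚ.*-distribˡ-+ c (Φ f) (Ψ f)))
  }
  where module Φ = IsLinear Φ-lin; module Ψ = IsLinear Ψ-lin

sub-linear : ∀ {Φ Ψ : Functional B} → IsLinear Φ → IsLinear Ψ → IsLinear (λ g → Φ g - Ψ g)
sub-linear {Φ = Φ} {Ψ = Ψ} Φ-lin Ψ-lin = record
  { resp   = λ f≗g → cong₂ _-_ (Φ.resp f≗g) (Ψ.resp f≗g)
  ; +-homo = λ f g → ≡.trans (cong₂ _-_ (Φ.+-homo f g) (Ψ.+-homo f g))
      (solve 4 (λ a b c d → (a :+ b) :- (c :+ d) := (a :- c) :+ (b :- d)) refl (Φ f) (Φ g) (Ψ f) (Ψ g))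
  ; *-homo = λ c f → ≡.trans (cong₂ _-_ (Φ.*-homo c f) (Ψ.*-homo c f))
      (solve 3 (λ c a b → c :* a :- c :* b := c :* (a :- b)) refl c (Φ f) (Ψ f))
  }
  where module Φ = IsLinear Φ-lin; module Ψ = IsLinear Ψ-lin

bind-linear : ∀ {Φ : Functional C} {Ψ : C → Functional B} →
              IsLinear Φ → (∀ c → IsLinear (Ψ c)) → IsLinear (λ g → Φ (λ c → Ψ c g))
bind-linear {Φ = Φ} {Ψ = Ψ} Φ-lin Ψ-lin = record
  { resp   = λ f≗g → Φ.resp (λ c → IsLinear.resp (Ψ-lin c) f≗g)
  ; +-homo = λ f g → ≡.trans (Φ.resp (λ c → IsLinear.+-homo (Ψ-lin c) f g)) (Φ.+-homo _ _)
  ; *-homo = λ k f → ≡.trans (Φ.resp (λ c → IsLinear.*-homo (Ψ-lin c) k f)) (Φ.*-homo k _)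
  }
  where module Φ = IsLinear Φ-lin

∑ : ∀ {B : Set} → List B → Functional B
∑ xs f = sumℚ (map f xs)

∑-linear : ∀ {B : Set} (xs : List B) → IsLinear (∑ xs)
∑-linear []       = record { resp = λ _ → refl ; +-homo = λ _ _ → refl ; *-homo = λ c _ → sym (ℚ.*-zeroʳ c) }
∑-linear (x ∷ xs) = +-linear {Φ = λ g → g x} {Ψ = ∑ xs} (eval-linear x) (∑-linear xs)

∑-comm : ∀ {B C : Set} {Φ : Functional C} → IsLinear Φ →
         ∀ (xs : List B) (h : C → B → ℚ) → Φ (λ c → ∑ xs (h c)) ≡ ∑ xs (λ b → Φ (λ c → h c b))
∑-comm Φ-lin []       h = IsLinear.0-homo Φ-lin
∑-comm {Φ = Φ} Φ-lin (x ∷ xs) h =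
  ≡.trans (IsLinear.+-homo Φ-lin _ _) (cong (Φ (λ c → h c x) +_) (∑-comm Φ-lin xs h))

module _ {B : Set} where

  ∑-++ : ∀ (xs ys : List B) f → ∑ (xs ++ ys) f ≡ ∑ xs f + ∑ ys f
  ∑-++ []       ys f = sym (ℚ.+-identityˡ _)
  ∑-++ (x ∷ xs) ys f = ≡.trans (cong (f x +_) (∑-++ xs ys f)) (sym (ℚ.+-assoc (f x) _ _))

  ∑-map : ∀ {C : Set} (h : C → B) xs f → ∑ (map h xs) f ≡ ∑ xs (f ∘ h)
  ∑-map h []       f = refl
  ∑-map h (x ∷ xs) f = cong (f (h x) +_) (∑-map h xs f)

  ∑-concatMap : ∀ {C : Set} (h : C → List B) xs f → ∑ (concatMap h xs) f ≡ ∑ xs (λ x → ∑ (h x) f)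
  ∑-concatMap h []       f = refl
  ∑-concatMap h (x ∷ xs) f = ≡.trans (∑-++ (h x) (concatMap h xs) f) (cong (∑ (h x) f +_) (∑-concatMap h xs f))

  ∑-filter : ∀ {p} {P : B → Set p} (P? : Decidable P) xs f → ∑ (filter P? xs) f ≡ ∑ xs (λ x → 𝟙 (P? x) * f x)
  ∑-filter P? []       f = refl
  ∑-filter P? (x ∷ xs) f with does (P? x)
  ... | true  = cong₂ _+_ (sym (ℚ.*-identityˡ (f x))) (∑-filter P? xs f)
  ... | false = ≡.trans (∑-filter P? xs f) (sym (≡.trans (cong (_+ _) (ℚ.*-zeroˡ (f x))) (ℚ.+-identityˡ _)))

-- Sums over insertions, permutations and shuffles

∑ins : A → List A → Functional (List A)
∑ins x []       g = g (x ∷ [])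
∑ins x (y ∷ ys) g = g (x ∷ y ∷ ys) + ∑ins x ys (g ∘ (y ∷_))

∑perm : List A → Functional (List A)
∑perm []       g = g []
∑perm (x ∷ xs) g = ∑perm xs (λ w → ∑ins x w g)

∑shuffle : List A → List A → Functional (List A)
∑shuffle []      v       g = g v
∑shuffle (a ∷ u) []      g = g (a ∷ u)
∑shuffle (a ∷ u) (b ∷ v) g = ∑shuffle u (b ∷ v) (g ∘ (a ∷_)) + ∑shuffle (a ∷ u) v (g ∘ (b ∷_))

∑ins-linear : ∀ (x : A) w → IsLinear (∑ins x w)
∑ins-linear x []       = eval-linear (x ∷ [])
∑ins-linear x (y ∷ ys) = +-linear {Φ = λ g → g (x ∷ y ∷ ys)} {Ψ = λ g → ∑ins x ys (g ∘ (y ∷_))}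
  (eval-linear _) (∘-linear (y ∷_) (∑ins-linear x ys))

∑perm-linear : ∀ (V : List A) → IsLinear (∑perm V)
∑perm-linear []       = eval-linear []
∑perm-linear (x ∷ xs) = bind-linear (∑perm-linear xs) (∑ins-linear x)

∑shuffle-linear : ∀ (u v : List A) → IsLinear (∑shuffle u v)
∑shuffle-linear []      v       = eval-linear v
∑shuffle-linear (a ∷ u) []      = eval-linear (a ∷ u)
∑shuffle-linear (a ∷ u) (b ∷ v) =
  +-linear {Φ = λ g → ∑shuffle u (b ∷ v) (g ∘ (a ∷_))} {Ψ = λ g → ∑shuffle (a ∷ u) v (g ∘ (b ∷_))}
    (∘-linear (a ∷_) (∑shuffle-linear u (b ∷ v))) (∘-linear (b ∷_) (∑shuffle-linear (a ∷ u) v))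

∑-insertions : ∀ (x : A) w g → ∑ (insertions x w) g ≡ ∑ins x w g
∑-insertions x []       g = ℚ.+-identityʳ (g (x ∷ []))
∑-insertions x (y ∷ ys) g = cong (g (x ∷ y ∷ ys) +_)
  (≡.trans (∑-map (y ∷_) (insertions x ys) g) (∑-insertions x ys (g ∘ (y ∷_))))

∑-perms : ∀ (V : List A) g → ∑ (perms V) g ≡ ∑perm V g
∑-perms []       g = ℚ.+-identityʳ (g [])
∑-perms (x ∷ xs) g = begin
  ∑ (concatMap (insertions x) (perms xs)) g  ≡⟨ ∑-concatMap (insertions x) (perms xs) g ⟩
  ∑ (perms xs) (λ w → ∑ (insertions x w) g)  ≡⟨ ∑-perms xs _ ⟩
  ∑perm xs (λ w → ∑ (insertions x w) g)      ≡⟨ IsLinear.resp (∑perm-linear xs) (λ w → ∑-insertions x w g) ⟩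
  ∑perm xs (λ w → ∑ins x w g)                ∎
  where open ≡-Reasoning

∑ins-cong↭ : ∀ (x : A) w {g h} → (∀ u → u ↭ x ∷ w → g u ≡ h u) → ∑ins x w g ≡ ∑ins x w h
∑ins-cong↭ x []       g≗h = g≗h _ ↭-refl
∑ins-cong↭ x (y ∷ ys) g≗h = cong₂ _+_ (g≗h _ ↭-refl)
  (∑ins-cong↭ x ys (λ u u↭ → g≗h (y ∷ u) (↭-trans (↭-prep y u↭) (↭-swap y x ↭-refl))))

∑perm-cong↭ : ∀ (V : List A) {g h} → (∀ w → w ↭ V → g w ≡ h w) → ∑perm V g ≡ ∑perm V h
∑perm-cong↭ []       g≗h = g≗h [] ↭-refl
∑perm-cong↭ (x ∷ xs) g≗h =
  ∑perm-cong↭ xs (λ w w↭ → ∑ins-cong↭ x w (λ u u↭ → g≗h u (↭-trans u↭ (↭-prep x w↭))))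

∑shuffle-cong : ∀ (u v : List A) {g h} → (∀ w → Interleaving u v w → g w ≡ h w) →
                ∑shuffle u v g ≡ ∑shuffle u v h
∑shuffle-cong []      v       g≗h = g≗h v (right ≋-refl)
∑shuffle-cong (a ∷ u) []      g≗h = g≗h (a ∷ u) (left ≋-refl)
∑shuffle-cong (a ∷ u) (b ∷ v) g≗h = cong₂ _+_
  (∑shuffle-cong u (b ∷ v) (λ w i → g≗h (a ∷ w) (consˡ i)))
  (∑shuffle-cong (a ∷ u) v (λ w i → g≗h (b ∷ w) (consʳ i)))

∑ins-comm : ∀ {Φ : Functional C} → IsLinear Φ →
            ∀ (x : A) w (h : C → List A → ℚ) →
            Φ (λ c → ∑ins x w (h c)) ≡ ∑ins x w (λ t → Φ (λ c → h c t))
∑ins-comm Φ-lin x []       h = refl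
∑ins-comm {Φ = Φ} Φ-lin x (y ∷ ys) h = ≡.trans (IsLinear.+-homo Φ-lin _ _)
  (cong (Φ (λ c → h c (x ∷ y ∷ ys)) +_) (∑ins-comm Φ-lin x ys (λ c → h c ∘ (y ∷_))))

∑shuffle-comm : ∀ (u v : List A) g → ∑shuffle u v g ≡ ∑shuffle v u g
∑shuffle-comm []      []      g = refl
∑shuffle-comm []      (b ∷ v) g = refl
∑shuffle-comm (a ∷ u) []      g = refl
∑shuffle-comm (a ∷ u) (b ∷ v) g =
  ≡.trans (cong₂ _+_ (∑shuffle-comm u (b ∷ v) _) (∑shuffle-comm (a ∷ u) v _))
          (ℚ.+-comm (∑shuffle (b ∷ v) u (g ∘ (a ∷_))) (∑shuffle v (a ∷ u) (g ∘ (b ∷_))))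

∑ins≡∑shuffle : ∀ (c : A) v g → ∑ins c v g ≡ ∑shuffle (c ∷ []) v g
∑ins≡∑shuffle c []      g = refl
∑ins≡∑shuffle c (b ∷ v) g = cong (g (c ∷ b ∷ v) +_) (∑ins≡∑shuffle c v (g ∘ (b ∷_)))

∑shuffle-[]ʳ : ∀ (u : List A) g → ∑shuffle u [] g ≡ g u
∑shuffle-[]ʳ []      g = refl
∑shuffle-[]ʳ (a ∷ u) g = refl

∑shuffle-∑ins : ∀ (c : A) u v g → ∑shuffle u v (λ w → ∑ins c w g) ≡ ∑ins c u (λ t → ∑shuffle t v g)
∑shuffle-∑ins c []      v       g = ∑ins≡∑shuffle c v g
∑shuffle-∑ins c (a ∷ u) []      g = IsLinear.resp (∑ins-linear c (a ∷ u)) (λ t → sym (∑shuffle-[]ʳ t g))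
∑shuffle-∑ins c (a ∷ u) (b ∷ v) g = begin
  ∑shuffle u (b ∷ v) (λ w → g (c ∷ a ∷ w) + ∑ins c w (g ∘ (a ∷_)))
    + ∑shuffle (a ∷ u) v (λ w → g (c ∷ b ∷ w) + ∑ins c w (g ∘ (b ∷_)))
      ≡⟨ cong₂ _+_ (IsLinear.+-homo (∑shuffle-linear u (b ∷ v)) _ _)
                   (IsLinear.+-homo (∑shuffle-linear (a ∷ u) v) _ _) ⟩
  (S₁ + ∑shuffle u (b ∷ v) (λ w → ∑ins c w (g ∘ (a ∷_))))
    + (S₂ + ∑shuffle (a ∷ u) v (λ w → ∑ins c w (g ∘ (b ∷_))))
      ≡⟨ cong₂ (λ s t → (S₁ + s) + (S₂ + t))
               (∑shuffle-∑ins c u (b ∷ v) _) (∑shuffle-∑ins c (a ∷ u) v _) ⟩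
  (S₁ + T₁) + (S₂ + (S₃ + T₂))
      ≡⟨ solve 5 (λ s₁ t₁ s₂ s₃ t₂ → (s₁ :+ t₁) :+ (s₂ :+ (s₃ :+ t₂))
                                   := ((s₁ :+ s₂) :+ s₃) :+ (t₁ :+ t₂))
               refl S₁ T₁ S₂ S₃ T₂ ⟩
  ((S₁ + S₂) + S₃) + (T₁ + T₂)
      ≡⟨ cong (((S₁ + S₂) + S₃) +_) (sym (IsLinear.+-homo (∑ins-linear c u) _ _)) ⟩
  ∑ins c (a ∷ u) (λ t → ∑shuffle t (b ∷ v) g) ∎
  where
  open ≡-Reasoning
  S₁ = ∑shuffle u (b ∷ v) (g ∘ (c ∷_) ∘ (a ∷_))
  S₂ = ∑shuffle (a ∷ u) v (g ∘ (c ∷_) ∘ (b ∷_))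
  S₃ = ∑shuffle (c ∷ a ∷ u) v (g ∘ (b ∷_))
  T₁ = ∑ins c u (λ t → ∑shuffle t (b ∷ v) (g ∘ (a ∷_)))
  T₂ = ∑ins c u (λ t → ∑shuffle (a ∷ t) v (g ∘ (b ∷_)))

∑perm-interleaving : ∀ {us vs ws : List A} → Interleaving us vs ws →
                     ∀ g → ∑perm ws g ≡ ∑perm us (λ u → ∑perm vs (λ v → ∑shuffle u v g))
∑perm-interleaving [] g = refl
∑perm-interleaving {us = c ∷ us} {vs = vs} {ws = _ ∷ ws} (consˡ i) g = begin
  ∑perm ws (λ w → ∑ins c w g)
    ≡⟨ ∑perm-interleaving i _ ⟩
  ∑perm us (λ u → ∑perm vs (λ v → ∑shuffle u v (λ w → ∑ins c w g)))
    ≡⟨ IsLinear.resp (∑perm-linear us) (λ u → IsLinear.resp (∑perm-linear vs) (λ v → ∑shuffle-∑ins c u v g)) ⟩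
  ∑perm us (λ u → ∑perm vs (λ v → ∑ins c u (λ t → ∑shuffle t v g)))
    ≡⟨ IsLinear.resp (∑perm-linear us) (λ u → ∑ins-comm (∑perm-linear vs) c u (λ v t → ∑shuffle t v g)) ⟩
  ∑perm us (λ u → ∑ins c u (λ t → ∑perm vs (λ v → ∑shuffle t v g))) ∎
  where open ≡-Reasoning
∑perm-interleaving {us = us} {vs = d ∷ vs} {ws = _ ∷ ws} (consʳ i) g = begin
  ∑perm ws (λ w → ∑ins d w g)
    ≡⟨ ∑perm-interleaving i _ ⟩
  ∑perm us (λ u → ∑perm vs (λ v → ∑shuffle u v (λ w → ∑ins d w g)))
    ≡⟨ IsLinear.resp (∑perm-linear us) (λ u → IsLinear.resp (∑perm-linear vs) (λ v → shuffle-ins u v)) ⟩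
  ∑perm us (λ u → ∑perm vs (λ v → ∑ins d v (λ t → ∑shuffle u t g))) ∎
  where
  open ≡-Reasoning
  shuffle-ins : ∀ u v → ∑shuffle u v (λ w → ∑ins d w g) ≡ ∑ins d v (λ t → ∑shuffle u t g)
  shuffle-ins u v = begin
    ∑shuffle u v (λ w → ∑ins d w g)   ≡⟨ ∑shuffle-comm u v _ ⟩
    ∑shuffle v u (λ w → ∑ins d w g)   ≡⟨ ∑shuffle-∑ins d v u g ⟩
    ∑ins d v (λ t → ∑shuffle t u g)   ≡⟨ IsLinear.resp (∑ins-linear d v) (λ t → ∑shuffle-comm t u g) ⟩
    ∑ins d v (λ t → ∑shuffle u t g)   ∎

Unique-resp-↭ : ∀ {xs ys : List A} → xs ↭ ys → Unique xs → Unique ys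
Unique-resp-↭ xs↭ys = PermSetoid.Unique-resp-↭ (≡.setoid _) (↭⇒↭ₛ xs↭ys)

SameRestrictions : ∀ {p} {P : A → Set p} → Decidable P → List A → List A → Set _
SameRestrictions P? w w′ = filter P? w ≡ filter P? w′ × filter (¬? ∘ P?) w ≡ filter (¬? ∘ P?) w′

filter-interleaving : ∀ {p} {P : A → Set p} (P? : Decidable P) {u v w} → Interleaving u v w →
                      All P u → All (¬_ ∘ P) v → filter P? w ≡ u × filter (¬? ∘ P?) w ≡ v
filter-interleaving P? []         _          _          = refl , refl
filter-interleaving P? (consˡ uvw) (Pa ∷ Pu) ¬Pv        =
  let (wP , w¬P) = filter-interleaving P? uvw Pu ¬Pv in
  ≡.trans (filter-accept P? Pa) (cong (_ ∷_) wP) ,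
  ≡.trans (filter-reject (¬? ∘ P?) (λ ¬Pa → ¬Pa Pa)) w¬P
filter-interleaving P? (consʳ uvw) Pu         (¬Pb ∷ ¬Pv) =
  let (wP , w¬P) = filter-interleaving P? uvw Pu ¬Pv in
  ≡.trans (filter-reject P? ¬Pb) wP ,
  ≡.trans (filter-accept (¬? ∘ P?) ¬Pb) (cong (_ ∷_) w¬P)

interleaving-sameRestrictions : ∀ {p} {P : A → Set p} (P? : Decidable P) {u v w} → Interleaving u v w →
                                All P u → All (¬_ ∘ P) v → SameRestrictions P? w (u ++ v)
interleaving-sameRestrictions P? {u} {v} uvw Pu ¬Pv =
  let (wP , w¬P) = filter-interleaving P? uvw Pu ¬Pv
      (uvP , uv¬P) = filter-interleaving P? (++-linear u v) Pu ¬Pv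
  in ≡.trans wP (sym uvP) , ≡.trans w¬P (sym uv¬P)

-- Greene's summand

module Greene {n : ℕ} (x : Fin n → ℚ) (x-injective : ∀ i j → x i ≡ x j → i ≡ j) where

  ψ : List (Fin n) → ℚ
  ψ w = inv (chainProd x w)

  ψ-∷∷ : ∀ a b w → ψ (a ∷ b ∷ w) ≡ inv (x a - x b) * ψ (b ∷ w)
  ψ-∷∷ a b w = inv-* (x a - x b) (chainProd x (b ∷ w))

  private
    x-≢ : ∀ {a b} → a ≢ b → x a ≢ x b
    x-≢ a≢b = a≢b ∘ x-injective _ _

    head≢ : ∀ {a b : Fin n} u v → All (a ≢_) (u ++ b ∷ v) → a ≢ b
    head≢ u v a∉ = All.lookup a∉ (∈-++⁺ʳ u (here refl))

  ∑shuffle-ψ-∷ : ∀ c u v → Unique (c ∷ u ++ v) →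
                 ∑shuffle u v (λ w → ψ (c ∷ w)) ≡ ψ (c ∷ u) * ψ (c ∷ v)
  ∑shuffle-ψ-∷ c []      v       _ = sym (ℚ.*-identityˡ _)
  ∑shuffle-ψ-∷ c (a ∷ u) []      _ = sym (ℚ.*-identityʳ _)
  ∑shuffle-ψ-∷ c (a ∷ u) (b ∷ v) ((c≢a ∷ c∉) ∷ U@(a∉ ∷ _)) = begin
    ∑shuffle u (b ∷ v) (λ w → ψ (c ∷ a ∷ w)) + ∑shuffle (a ∷ u) v (λ w → ψ (c ∷ b ∷ w))
      ≡⟨ cong₂ _+_ (IsLinear.resp (∑shuffle-linear u (b ∷ v)) (ψ-∷∷ c a))
                   (IsLinear.resp (∑shuffle-linear (a ∷ u) v) (ψ-∷∷ c b)) ⟩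
    ∑shuffle u (b ∷ v) (λ w → Ica * ψ (a ∷ w)) + ∑shuffle (a ∷ u) v (λ w → Icb * ψ (b ∷ w))
      ≡⟨ cong₂ _+_ (IsLinear.*-homo (∑shuffle-linear u (b ∷ v)) Ica _)
                   (IsLinear.*-homo (∑shuffle-linear (a ∷ u) v) Icb _) ⟩
    Ica * ∑shuffle u (b ∷ v) (λ w → ψ (a ∷ w)) + Icb * ∑shuffle (a ∷ u) v (λ w → ψ (b ∷ w))
      ≡⟨ cong₂ (λ s t → Ica * s + Icb * t) (∑shuffle-ψ-∷ a u (b ∷ v) U)
               (∑shuffle-ψ-∷ b (a ∷ u) v (Unique-resp-↭ (shift b (a ∷ u) v) U)) ⟩
    Ica * (Fa * ψ (a ∷ b ∷ v)) + Icb * (ψ (b ∷ a ∷ u) * Fb)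
      ≡⟨ cong₂ (λ s t → Ica * (Fa * s) + Icb * (t * Fb)) (ψ-∷∷ a b v) (ψ-∷∷ b a u) ⟩
    Ica * (Fa * (Iab * Fb)) + Icb * ((Iba * Fa) * Fb)
      ≡⟨ solve 6 (λ ica icb iab iba fa fb → ica :* (fa :* (iab :* fb)) :+ icb :* ((iba :* fa) :* fb)
                                          := (ica :* iab :+ icb :* iba) :* (fa :* fb))
               refl Ica Icb Iab Iba Fa Fb ⟩
    (Ica * Iab + Icb * Iba) * (Fa * Fb)
      ≡⟨ cong (_* (Fa * Fb)) (partial-fractions (x-≢ (head≢ u v a∉)) (x-≢ c≢a) (x-≢ (head≢ u v c∉))) ⟩
    (Ica * Icb) * (Fa * Fb)
      ≡⟨ solve 4 (λ ica icb fa fb → (ica :* icb) :* (fa :* fb) := (ica :* fa) :* (icb :* fb)) refl Ica Icb Fa Fb ⟩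
    (Ica * Fa) * (Icb * Fb)
      ≡⟨ sym (cong₂ _*_ (ψ-∷∷ c a u) (ψ-∷∷ c b v)) ⟩
    ψ (c ∷ a ∷ u) * ψ (c ∷ b ∷ v) ∎
    where
    open ≡-Reasoning
    Ica = inv (x c - x a)
    Icb = inv (x c - x b)
    Iab = inv (x a - x b)
    Iba = inv (x b - x a)
    Fa = ψ (a ∷ u)
    Fb = ψ (b ∷ v)

  ∑shuffle-ψ≡0 : ∀ a u b v → Unique (a ∷ u ++ b ∷ v) → ∑shuffle (a ∷ u) (b ∷ v) ψ ≡ 0ℚ
  ∑shuffle-ψ≡0 a u b v U = begin
    ∑shuffle u (b ∷ v) (λ w → ψ (a ∷ w)) + ∑shuffle (a ∷ u) v (λ w → ψ (b ∷ w))
      ≡⟨ cong₂ _+_ (∑shuffle-ψ-∷ a u (b ∷ v) U)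
                   (∑shuffle-ψ-∷ b (a ∷ u) v (Unique-resp-↭ (shift b (a ∷ u) v) U)) ⟩
    Fa * ψ (a ∷ b ∷ v) + ψ (b ∷ a ∷ u) * Fb
      ≡⟨ cong₂ (λ s t → Fa * s + t * Fb) (ψ-∷∷ a b v) (ψ-∷∷ b a u) ⟩
    Fa * (Iab * Fb) + (inv (x b - x a) * Fa) * Fb
      ≡⟨ cong (λ t → Fa * (Iab * Fb) + (t * Fa) * Fb) (inv-sub-swap (x a) (x b)) ⟩
    Fa * (Iab * Fb) + ((- Iab) * Fa) * Fb
      ≡⟨ solve 3 (λ fa fb i → fa :* (i :* fb) :+ ((:- i) :* fa) :* fb := con 0ℚ) refl Fa Fb Iab ⟩
    0ℚ ∎
    where
    open ≡-Reasoning
    Iab = inv (x a - x b)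
    Fa = ψ (a ∷ u)
    Fb = ψ (b ∷ v)

  -- Split the letters by P: every permutation is a shuffle of a permutation
  -- of each side, and k is constant on the shuffles of two given words.
  ∑perm-ψ≡0 : ∀ {p} {P : Fin n → Set p} (P? : Decidable P) {u₀ v₀} → P u₀ → ¬ P v₀ →
              (k : List (Fin n) → ℚ) → (∀ {w w′} → SameRestrictions P? w w′ → k w ≡ k w′) →
              ∑perm (allFin n) (λ w → k w * ψ w) ≡ 0ℚ
  ∑perm-ψ≡0 {P = P} P? {u₀} {v₀} Pu₀ ¬Pv₀ k k-resp = begin
    ∑perm (allFin n) g                              ≡⟨ ∑perm-interleaving split g ⟩
    ∑perm L (λ u → ∑perm R (λ v → ∑shuffle u v g))  ≡⟨ ∑perm-cong↭ L (λ u u↭L → ≡.trans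
                                                         (∑perm-cong↭ R (λ v v↭R → shuffles≡0 u↭L v↭R))
                                                         (IsLinear.0-homo (∑perm-linear R))) ⟩
    ∑perm L (λ _ → 0ℚ)                              ≡⟨ IsLinear.0-homo (∑perm-linear L) ⟩
    0ℚ                                              ∎
    where
    open ≡-Reasoning
    g : List (Fin n) → ℚ
    g w = k w * ψ w
    L = filter P? (allFin n)
    R = filter (¬? ∘ P?) (allFin n)
    split : Interleaving L R (allFin n)
    split = filter⁺ P? (allFin n)

    shuffles≡0 : ∀ {u v} → u ↭ L → v ↭ R → ∑shuffle u v g ≡ 0ℚ
    shuffles≡0 {u} {v} u↭L v↭R = begin
      ∑shuffle u v g                          ≡⟨ ∑shuffle-cong u v (λ w uvw →
                                                   cong (_* ψ w) (k-resp (interleaving-sameRestrictions P? uvw Pu ¬Pv))) ⟩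
      ∑shuffle u v (λ w → k (u ++ v) * ψ w)   ≡⟨ IsLinear.*-homo (∑shuffle-linear u v) (k (u ++ v)) ψ ⟩
      k (u ++ v) * ∑shuffle u v ψ             ≡⟨ cong (k (u ++ v) *_) (nonempty u₀∈u v₀∈v unique) ⟩
      k (u ++ v) * 0ℚ                         ≡⟨ ℚ.*-zeroʳ (k (u ++ v)) ⟩
      0ℚ                                      ∎
      where
      Pu : All P u
      Pu = All-resp-↭ (↭-sym u↭L) (all-filter P? (allFin n))
      ¬Pv : All (¬_ ∘ P) v
      ¬Pv = All-resp-↭ (↭-sym v↭R) (all-filter (¬? ∘ P?) (allFin n))
      u₀∈u : u₀ ∈ u
      u₀∈u = ∈-resp-↭ (↭-sym u↭L) (∈-filter⁺ P? (∈-allFin u₀) Pu₀)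
      v₀∈v : v₀ ∈ v
      v₀∈v = ∈-resp-↭ (↭-sym v↭R) (∈-filter⁺ (¬? ∘ P?) (∈-allFin v₀) ¬Pv₀)
      unique : Unique (u ++ v)
      unique = Unique-resp-↭ (↭-trans (toPermutation split) (↭-sym (++⁺ u↭L v↭R))) (allFin⁺ n)
      nonempty : ∀ {u v} → u₀ ∈ u → v₀ ∈ v → Unique (u ++ v) → ∑shuffle u v ψ ≡ 0ℚ
      nonempty {a ∷ u} {b ∷ v} _ _ = ∑shuffle-ψ≡0 a u b v

  Ψ≡∑perm : ∀ Q → Ψ Q x ≡ ∑perm (allFin n) (λ w → 𝟙 (isLinExt Q w Bool.≟ true) * ψ w)
  Ψ≡∑perm Q = ≡.trans (∑-filter (λ w → isLinExt Q w Bool.≟ true) (perms (allFin n)) ψ) (∑-perms (allFin n) _)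

-- Inversions and linear extensions

module _ {n : ℕ} where

  open DecMembership (Fin._≟_ {n}) using (_∈?_)

  Inverted : List (Fin n) → Fin n → Fin n → Set
  Inverted []      i j = ⊥
  Inverted (h ∷ w) i j = (h ≡ j × i ∈ w) ⊎ Inverted w i j

  inverted? : ∀ w i j → Dec (Inverted w i j)
  inverted? []      i j = no (λ ())
  inverted? (h ∷ w) i j = ((h Fin.≟ j) ×-dec (i ∈? w)) ⊎-dec inverted? w i j

  Inverted-filter : ∀ {p} {P : Fin n → Set p} (P? : Decidable P) {i j} → P i → P j →
                    ∀ w → Inverted w i j ⇔ Inverted (filter P? w) i j
  Inverted-filter P? Pi Pj []      = mk⇔ id id
  Inverted-filter {P = P} P? {i} Pi Pj (h ∷ w) with P? h
  ... | yes _  = mk⇔ (Sum.map₂ (Equivalence.to IH) ∘ Sum.map₁ (Product.map₂ (λ i∈w → ∈-filter⁺ P? i∈w Pi)))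
                     (Sum.map₂ (Equivalence.from IH) ∘ Sum.map₁ (Product.map₂ (proj₁ ∘ ∈-filter⁻ P?)))
    where IH = Inverted-filter P? Pi Pj w
  ... | no ¬Ph = mk⇔ [ (λ (h≡j , _) → contradiction (≡.subst P (sym h≡j) Pj) ¬Ph) , Equivalence.to IH ]
                     (inj₂ ∘ Equivalence.from IH)
    where IH = Inverted-filter P? Pi Pj w

  private
    through-filter : ∀ {q} {Q : Fin n → Set q} (Q? : Decidable Q) {w w′ i j} →
                     (∀ u → Inverted u i j ⇔ Inverted (filter Q? u) i j) →
                     filter Q? w ≡ filter Q? w′ → Inverted w i j ⇔ Inverted w′ i j
    through-filter Q? {w} {w′} {i} {j} restrict same =
      Eqv.trans (restrict w) (≡.subst (λ u → u ⇔ Inverted w′ i j) (cong (λ u → Inverted u i j) (sym same))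
                                     (Eqv.sym (restrict w′)))

  Inverted-cong : ∀ {p} {P : Fin n → Set p} (P? : Decidable P) {w w′ i j} →
                  SameRestrictions P? w w′ → (P i ⇔ P j) → Inverted w i j ⇔ Inverted w′ i j
  Inverted-cong P? {i = i} (sameP , same¬P) Pi⇔Pj with P? i
  ... | yes Pi = through-filter P? (Inverted-filter P? Pi (Equivalence.to Pi⇔Pj Pi)) sameP
  ... | no ¬Pi = through-filter (¬? ∘ P?) (Inverted-filter (¬? ∘ P?) ¬Pi (¬Pi ∘ Equivalence.from Pi⇔Pj)) same¬P

  isLinExt-⇔ : ∀ (Q : NLPoset n) w → isLinExt Q w ≡ true ⇔ (∀ i j → lt Q i j ≡ true → ¬ Inverted w i j)
  isLinExt-⇔ Q []      = mk⇔ (λ _ _ _ _ ()) (λ _ → refl)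
  isLinExt-⇔ Q (h ∷ w) = mk⇔ to from
    where
    IH = isLinExt-⇔ Q w

    to : isLinExt Q (h ∷ w) ≡ true → ∀ i j → lt Q i j ≡ true → ¬ Inverted (h ∷ w) i j
    to ext i j i<j (inj₁ (refl , i∈w)) with () ← ≡.trans (cong not (sym i<j))
      (All.lookup (Equivalence.to (allB-⇔ _ w) (∧-conicalˡ _ _ ext)) i∈w)
    to ext i j i<j (inj₂ inv) = Equivalence.to IH (∧-conicalʳ _ _ ext) i j i<j inv

    from : (∀ i j → lt Q i j ≡ true → ¬ Inverted (h ∷ w) i j) → isLinExt Q (h ∷ w) ≡ true
    from noInv = cong₂ _∧_ (Equivalence.from (allB-⇔ _ w) (All.tabulate notBelow))
                           (Equivalence.from IH (λ i j i<j → noInv i j i<j ∘ inj₂))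
      where
      notBelow : ∀ {y} → y ∈ w → not (lt Q y h) ≡ true
      notBelow {y} y∈w with lt Q y h in y<h
      ... | true  = contradiction (inj₁ (refl , y∈w)) (noInv y h y<h)
      ... | false = refl

  Inverted⇒∈ : ∀ {w i j} → Inverted w i j → i ∈ w
  Inverted⇒∈ {h ∷ w} (inj₁ (_ , i∈w)) = there i∈w
  Inverted⇒∈ {h ∷ w} (inj₂ inv)       = there (Inverted⇒∈ inv)

  Inverted-trans : ∀ {w i j k} → Unique w → Inverted w i j → Inverted w j k → Inverted w i k
  Inverted-trans {_ ∷ _} (h∉w ∷ _) (inj₁ (h≡j , _)) (inj₁ (_ , j∈w)) = contradiction h≡j (All.lookup h∉w j∈w)
  Inverted-trans {_ ∷ _} (h∉w ∷ _) (inj₁ (h≡j , _)) (inj₂ jk)        =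
    contradiction h≡j (All.lookup h∉w (Inverted⇒∈ jk))
  Inverted-trans {_ ∷ _} _            (inj₂ ij) (inj₁ (h≡k , _)) = inj₁ (h≡k , Inverted⇒∈ ij)
  Inverted-trans {_ ∷ _} (_ ∷ unique) (inj₂ ij) (inj₂ jk)        = inj₂ (Inverted-trans unique ij jk)

Pair : ℕ → Set
Pair n = Fin n × Fin n

allPairs : ∀ n → List (Pair n)
allPairs n = cartesianProductWith (λ j i → (i , j)) (allFin n) (allFin n)

ColumnSorted : ∀ {n} → List (Pair n) → Set
ColumnSorted = AllPairs (λ e e′ → proj₂ e Fin.≤ proj₂ e′)

∈-allPairs : ∀ {n} (e : Pair n) → e ∈ allPairs n
∈-allPairs (i , j) = ∈-cartesianProductWith⁺ (λ j i → (i , j)) (∈-allFin j) (∈-allFin i)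

tabulate-sorted : ∀ {m n} (f : Fin m → Fin n) → (∀ {i j} → i Fin.< j → f i Fin.< f j) →
                  AllPairs Fin._<_ (tabulate f)
tabulate-sorted {zero}  f f-mono = []
tabulate-sorted {suc m} f f-mono = AllP.tabulate⁺ (λ _ → f-mono z<s) ∷ tabulate-sorted (f ∘ Fin.suc) (f-mono ∘ s<s)

allPairs-sorted : ∀ {n} → ColumnSorted (allPairs n)
allPairs-sorted {n} = columns (tabulate-sorted id id)
  where
  columns : ∀ {js} → AllPairs Fin._<_ js → ColumnSorted (cartesianProductWith (λ j i → (i , j)) js (allFin n))
  columns []              = []
  columns {j ∷ js} (j< ∷ sorted) = AllPairsP.++⁺ (AllPairsP.map⁺ (AllPairsP.tabulate⁺ (λ _ → FinP.≤-refl)))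
    (columns sorted) (All.tabulate λ e∈column → All.tabulate λ e′∈rest → earlier e∈column e′∈rest)
    where
    earlier : ∀ {e e′} → e ∈ map (λ i → (i , j)) (allFin n) →
              e′ ∈ cartesianProductWith (λ j i → (i , j)) js (allFin n) → proj₂ e Fin.≤ proj₂ e′
    earlier e∈ e′∈
      with ∈-map⁻ (λ i → (i , j)) e∈ | ∈-cartesianProductWith⁻ (λ j i → (i , j)) js (allFin n) e′∈
    ... | _ , _ , refl | _ , _ , j′∈js , _ , refl = NatP.<⇒≤ (All.lookup j< j′∈js)

module _ {n : ℕ} where

  Inversion : NLPoset n → List (Fin n) → Pair n → Set
  Inversion Q w (i , j) = lt Q i j ≡ true × Inverted w i j

  inversion? : ∀ Q w → Decidable (Inversion Q w)
  inversion? Q w (i , j) = (lt Q i j Bool.≟ true) ×-dec inverted? w i j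

  𝟙-isLinExt : ∀ Q w → 𝟙 (isLinExt Q w Bool.≟ true) ≡ 𝟙 (all? (¬? ∘ inversion? Q w) (allPairs n))
  𝟙-isLinExt Q w = 𝟙-cong (isLinExt Q w Bool.≟ true) (all? (¬? ∘ inversion? Q w) (allPairs n))
    (Eqv.trans (isLinExt-⇔ Q w) (mk⇔
      (λ noInv → All.tabulate λ { {i , j} _ (i<j , inv) → noInv i j i<j inv })
      (λ noInv i j i<j inv → All.lookup noInv (∈-allPairs (i , j)) (i<j , inv))))

  Inversion-trans : ∀ (Q : NLPoset n) {w} → Unique w → ∀ {i j k} →
                    Inversion Q w (i , j) → Inversion Q w (j , k) → Inversion Q w (i , k)
  Inversion-trans Q unique (i<j , ij) (j<k , jk) = NLPoset.trans Q _ _ _ i<j j<k , Inverted-trans unique ij jk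

-- The posets P_{L,R}

module _ {n : ℕ} where

  Crossing : Vec Bool n → Pair n → Set
  Crossing s (i , j) = lookup s i ≡ true × lookup s j ≡ false

  crossing? : ∀ s → Decidable (Crossing s)
  crossing? s (i , j) = (lookup s i Bool.≟ true) ×-dec (lookup s j Bool.≟ false)

  crossLt : NLPoset n → Vec Bool n → Fin n → Fin n → Bool
  crossLt P s i j = lt P i j ∧ (lookup s i ∧ not (lookup s j))

  crossLt-⇔ : ∀ P s {i j} → crossLt P s i j ≡ true ⇔ (lt P i j ≡ true × Crossing s (i , j))
  crossLt-⇔ P s = Eqv.trans ∧-⇔ (Eqv.refl ×-⇔ Eqv.trans ∧-⇔ (Eqv.refl ×-⇔ not-⇔))

  crossLt-noChain : ∀ P s {i j k} → crossLt P s i j ≡ true → crossLt P s j k ≡ true → ⊥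
  crossLt-noChain P s i<j j<k with () ← ≡.trans (sym (proj₂ (proj₂ (Equivalence.to (crossLt-⇔ P s) i<j))))
                                                (proj₁ (proj₂ (Equivalence.to (crossLt-⇔ P s) j<k)))

  crossPoset : NLPoset n → Vec Bool n → NLPoset n
  crossPoset P s = record
    { lt      = crossLt P s
    ; irrefl  = λ i → cong (_∧ _) (irrefl P i)
    ; trans   = λ _ _ _ i<j j<k → ⊥-elim (crossLt-noChain P s i<j j<k)
    ; natural = λ i j i<j → natural P i j (∧-conicalˡ _ _ i<j)
    }

  crossPoset⇒GEdge : ∀ P s {i j} → lt (crossPoset P s) i j ≡ true → GEdge P s i j
  crossPoset⇒GEdge P s {i} {j} i<j =
    let (i<ₚj , si , sj) = Equivalence.to (crossLt-⇔ P s) i<j in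
    i<ₚj , si , sj , natural P i j i<ₚj

  cover⇔GEdge : ∀ P s i j → Cover (crossPoset P s) i j ⇔ GEdge P s i j
  cover⇔GEdge P s i j = mk⇔ (crossPoset⇒GEdge P s ∘ proj₁)
    (λ (i<j , si , sj , _) → Equivalence.from (crossLt-⇔ P s) (i<j , si , sj) , λ _ → crossLt-noChain P s)

  Inversion-crossPoset : ∀ P s w e → Inversion (crossPoset P s) w e ⇔ (Inversion P w e × Crossing s e)
  Inversion-crossPoset P s w (i , j) = mk⇔
    (λ (i<j , inv) → let (i<ₚj , si , sj) = Equivalence.to (crossLt-⇔ P s) i<j in (i<ₚj , inv) , si , sj)
    (λ ((i<ₚj , inv) , si , sj) → Equivalence.from (crossLt-⇔ P s) (i<ₚj , si , sj) , inv)

-- Signed sums over sublists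

-- ∑± es h = Σ_{A ⊆ es} (-1)^|A| h A, each sublist A listed in the order of es
∑± : List B → Functional (List B)
∑± []       h = h []
∑± (e ∷ es) h = ∑± es h - ∑± es (h ∘ (e ∷_))

∑±-linear : ∀ (es : List B) → IsLinear (∑± es)
∑±-linear []       = eval-linear []
∑±-linear (e ∷ es) = sub-linear {Φ = ∑± es} {Ψ = λ h → ∑± es (h ∘ (e ∷_))}
  (∑±-linear es) (∘-linear (e ∷_) (∑±-linear es))

∑±-comm : ∀ {Φ : Functional C} → IsLinear Φ → ∀ (es : List B) (h : C → List B → ℚ) →
          Φ (λ c → ∑± es (h c)) ≡ ∑± es (λ A → Φ (λ c → h c A))
∑±-comm Φ-lin []       h = refl
∑±-comm Φ-lin (e ∷ es) h = ≡.trans (IsLinear.sub-homo Φ-lin _ _)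
  (cong₂ _-_ (∑±-comm Φ-lin es h) (∑±-comm Φ-lin es (λ c → h c ∘ (e ∷_))))

∑±-all : ∀ {p} {P : B → Set p} (P? : Decidable P) es →
         ∑± es (λ A → 𝟙 (all? P? A)) ≡ 𝟙 (all? (¬? ∘ P?) es)
∑±-all P? []       = refl
∑±-all {P = P} P? (e ∷ es) = cases (P? e)
  where
  open ≡-Reasoning
  cases : Dec (P e) → ∑± es (λ A → 𝟙 (all? P? A)) - ∑± es (λ A → 𝟙 (all? P? (e ∷ A))) ≡
                      𝟙 (all? (¬? ∘ P?) (e ∷ es))
  cases (yes Pe) = begin
    ∑± es (λ A → 𝟙 (all? P? A)) - ∑± es (λ A → 𝟙 (all? P? (e ∷ A)))
      ≡⟨ cong (_-_ (∑± es (λ A → 𝟙 (all? P? A)))) (IsLinear.resp (∑±-linear es)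
           (λ A → 𝟙-cong (all? P? (e ∷ A)) (all? P? A) (mk⇔ All.tail (Pe ∷_)))) ⟩
    ∑± es (λ A → 𝟙 (all? P? A)) - ∑± es (λ A → 𝟙 (all? P? A))
      ≡⟨ ℚ.+-inverseʳ (∑± es (λ A → 𝟙 (all? P? A))) ⟩
    0ℚ
      ≡⟨ sym (𝟙-no (all? (¬? ∘ P?) (e ∷ es)) (λ ¬P-all → All.head ¬P-all Pe)) ⟩
    𝟙 (all? (¬? ∘ P?) (e ∷ es)) ∎
  cases (no ¬Pe) = begin
    ∑± es (λ A → 𝟙 (all? P? A)) - ∑± es (λ A → 𝟙 (all? P? (e ∷ A)))
      ≡⟨ cong (_-_ (∑± es (λ A → 𝟙 (all? P? A)))) (IsLinear.vanishes (∑±-linear es)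
           (λ A → 𝟙-no (all? P? (e ∷ A)) (¬Pe ∘ All.head))) ⟩
    ∑± es (λ A → 𝟙 (all? P? A)) - 0ℚ
      ≡⟨ ℚ.+-identityʳ _ ⟩
    ∑± es (λ A → 𝟙 (all? P? A))
      ≡⟨ ∑±-all P? es ⟩
    𝟙 (all? (¬? ∘ P?) es)
      ≡⟨ 𝟙-cong (all? (¬? ∘ P?) es) (all? (¬? ∘ P?) (e ∷ es)) (mk⇔ (¬Pe ∷_) All.tail) ⟩
    𝟙 (all? (¬? ∘ P?) (e ∷ es)) ∎

module _ {n : ℕ} where

  Bipartite : List (Pair n) → Set
  Bipartite A = ∀ {e e′} → e ∈ A → e′ ∈ A → proj₂ e ≢ proj₁ e′

  bipartite? : Decidable Bipartite
  bipartite? A = map′ (λ all e∈ e′∈ → All.lookup (All.lookup all e∈) e′∈)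
                      (λ bip → All.tabulate λ e∈ → All.tabulate λ e′∈ → bip e∈ e′∈)
                      (all? (λ e → all? (λ e′ → ¬? (proj₂ e Fin.≟ proj₁ e′)) A) A)

  Compatible : Pair n → Pair n → Set
  Compatible (i , k) (a , b) = b ≢ i × k ≢ a

  compatible? : ∀ e → Decidable (Compatible e)
  compatible? (i , k) (a , b) = ¬? (b Fin.≟ i) ×-dec ¬? (k Fin.≟ a)

  bipartite-∷ : ∀ {e A} → Bipartite (e ∷ A) ⇔ (proj₂ e ≢ proj₁ e × All (Compatible e) A × Bipartite A)
  bipartite-∷ = mk⇔
    (λ bip → bip (here refl) (here refl)
           , All.tabulate (λ e′∈ → bip (there e′∈) (here refl) , bip (here refl) (there e′∈))
           , λ {_} {_} e∈ e′∈ → bip (there e∈) (there e′∈))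
    (λ { (k≢i , compatible , bip) → λ
         { (here refl) (here refl)  → k≢i
         ; (here refl) (there e′∈)  → proj₂ (All.lookup compatible e′∈)
         ; (there e∈)  (here refl)  → proj₁ (All.lookup compatible e∈)
         ; (there e∈)  (there e′∈)  → bip e∈ e′∈ } })

  ClosedIn : (Pair n → Set) → List (Pair n) → Set
  ClosedIn I es = ∀ {a b c} → I (a , b) → I (b , c) → (a , b) ∈ es → (b , c) ∈ es → (a , c) ∈ es

  private
    closedIn-tail : ∀ {I e es} → ClosedIn I (e ∷ es) →
                    (∀ {a b c} → I (a , b) → I (b , c) → (a , b) ∈ es → (b , c) ∈ es → (a , c) ≢ e) →
                    ClosedIn I es
    closedIn-tail closed ≢e Iab Ibc ab∈ bc∈ with closed Iab Ibc (there ab∈) (there bc∈)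
    ... | here ac≡e = contradiction ac≡e (≢e Iab Ibc ab∈ bc∈)
    ... | there ac∈ = ac∈

  -- A bipartite set starting with the first pair (i , k) of es is (i , k) added
  -- to one avoiding the pairs into i and out of k.  Removing these pairs from I
  -- leaves I nonempty on es if it was: pairs of I into i precede (i , k) in
  -- column order, and a pair (k , b) of I yields the pair (i , b) of I.
  ∑±-bipartite : ∀ {I : Pair n → Set} (I? : Decidable I) →
                 (∀ {i j} → I (i , j) → i Fin.< j) → (∀ {i j k} → I (i , j) → I (j , k) → I (i , k)) →
                 ∀ es → ColumnSorted es → ClosedIn I es →
                 ∑± es (λ A → 𝟙 (all? I? A ×-dec bipartite? A)) ≡ 𝟙 (all? (¬? ∘ I?) es)
  ∑±-bipartite I? increasing transitive []       _ _ = refl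
  ∑±-bipartite {I} I? increasing transitive ((i , k) ∷ es) (k≤ ∷ sorted) closed = cases (I? (i , k))
    where
    open ≡-Reasoning
    h : List (Pair n) → ℚ
    h A = 𝟙 (all? I? A ×-dec bipartite? A)

    cases : Dec (I (i , k)) → ∑± es h - ∑± es (h ∘ ((i , k) ∷_)) ≡ 𝟙 (all? (¬? ∘ I?) ((i , k) ∷ es))
    cases (no ¬Iik) = begin
      ∑± es h - ∑± es (h ∘ ((i , k) ∷_))
        ≡⟨ cong (_-_ (∑± es h)) (IsLinear.vanishes (∑±-linear es)
             (λ A → 𝟙-no (all? I? ((i , k) ∷ A) ×-dec bipartite? ((i , k) ∷ A)) (¬Iik ∘ All.head ∘ proj₁))) ⟩
      ∑± es h - 0ℚ
        ≡⟨ ℚ.+-identityʳ (∑± es h) ⟩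
      ∑± es h
        ≡⟨ ∑±-bipartite I? increasing transitive es sorted
             (closedIn-tail closed (λ Iab Ibc _ _ ac≡ik → ¬Iik (≡.subst I ac≡ik (transitive Iab Ibc)))) ⟩
      𝟙 (all? (¬? ∘ I?) es)
        ≡⟨ 𝟙-cong (all? (¬? ∘ I?) es) (all? (¬? ∘ I?) ((i , k) ∷ es)) (mk⇔ (¬Iik ∷_) All.tail) ⟩
      𝟙 (all? (¬? ∘ I?) ((i , k) ∷ es)) ∎
    cases (yes Iik) = begin
      ∑± es h - ∑± es (h ∘ ((i , k) ∷_))
        ≡⟨ cong (_-_ (∑± es h)) (IsLinear.resp (∑±-linear es) (λ A →
             𝟙-cong (all? I? ((i , k) ∷ A) ×-dec bipartite? ((i , k) ∷ A)) (all? J? A ×-dec bipartite? A) extend)) ⟩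
      ∑± es h - ∑± es (λ A → 𝟙 (all? J? A ×-dec bipartite? A))
        ≡⟨ cong₂ _-_ (∑±-bipartite I? increasing transitive es sorted closedI)
                     (∑±-bipartite J? (increasing ∘ proj₁) transitiveJ es sorted
                                   (λ Jab Jbc → closedI (proj₁ Jab) (proj₁ Jbc))) ⟩
      𝟙 (all? (¬? ∘ I?) es) - 𝟙 (all? (¬? ∘ J?) es)
        ≡⟨ cong (_-_ (𝟙 (all? (¬? ∘ I?) es))) (𝟙-cong (all? (¬? ∘ J?) es) (all? (¬? ∘ I?) es) noJ⇔noI) ⟩
      𝟙 (all? (¬? ∘ I?) es) - 𝟙 (all? (¬? ∘ I?) es)
        ≡⟨ ℚ.+-inverseʳ (𝟙 (all? (¬? ∘ I?) es)) ⟩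
      0ℚ
        ≡⟨ sym (𝟙-no (all? (¬? ∘ I?) ((i , k) ∷ es)) (λ noI → All.head noI Iik)) ⟩
      𝟙 (all? (¬? ∘ I?) ((i , k) ∷ es)) ∎
      where
      i<k = increasing Iik

      J : Pair n → Set
      J e = I e × Compatible (i , k) e
      J? : Decidable J
      J? e = I? e ×-dec compatible? (i , k) e

      extend : ∀ {A} → (All I ((i , k) ∷ A) × Bipartite ((i , k) ∷ A)) ⇔ (All J A × Bipartite A)
      extend = mk⇔
        (λ { ((_ ∷ IA) , bip) → let (_ , compatible , bipA) = Equivalence.to bipartite-∷ bip in
                                All.zip (IA , compatible) , bipA })
        (λ (JA , bipA) → let (IA , compatible) = All.unzip JA in
                         Iik ∷ IA , Equivalence.from bipartite-∷ (FinP.<⇒≢ i<k ∘ sym , compatible , bipA))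

      transitiveJ : ∀ {a b c} → J (a , b) → J (b , c) → J (a , c)
      transitiveJ (Iab , _ , k≢a) (Ibc , c≢i , _) = transitive Iab Ibc , c≢i , k≢a

      closedI : ClosedIn I es
      closedI = closedIn-tail closed λ { _ Ibk ib∈ _ refl →
        NatP.<⇒≱ (increasing Ibk) (All.lookup k≤ ib∈) }

      noJ⇔noI : All (¬_ ∘ J) es ⇔ All (¬_ ∘ I) es
      noJ⇔noI = mk⇔ (λ noJ → All.tabulate (λ ab∈ Iab → noJ-noI noJ ab∈ Iab))
                    (All.map (λ ¬I → ¬I ∘ proj₁))
        where
        noJ-noI : All (¬_ ∘ J) es → ∀ {a b} → (a , b) ∈ es → ¬ I (a , b)
        noJ-noI noJ {a} {b} ab∈ Iab with b Fin.≟ i | k Fin.≟ a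
        ... | yes refl | _       = NatP.<⇒≱ i<k (All.lookup k≤ ab∈)
        ... | no b≢i   | yes refl with closed Iik Iab (here refl) (there ab∈)
        ...   | here ib≡ik = FinP.<⇒≢ (increasing Iab) (sym (cong proj₂ ib≡ik))
        ...   | there ib∈  = All.lookup noJ ib∈ (transitive Iik Iab , FinP.<⇒≢ i<b ∘ sym , FinP.<⇒≢ i<k ∘ sym)
          where i<b = FinP.<-trans i<k (increasing Iab)
        noJ-noI noJ ab∈ Iab | no b≢i | no k≢a = All.lookup noJ ab∈ (Iab , b≢i , k≢a)

allSubsets : ∀ n → List (Vec Bool n)
allSubsets zero    = Vec.[] ∷ []
allSubsets (suc n) = cartesianProductWith Vec._∷_ (true ∷ false ∷ []) (allSubsets n)

∈-allSubsets : ∀ {n} (s : Vec Bool n) → s ∈ allSubsets n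
∈-allSubsets Vec.[]          = here refl
∈-allSubsets (true  Vec.∷ s) = ∈-cartesianProductWith⁺ Vec._∷_ {xs = true ∷ false ∷ []} (here refl) (∈-allSubsets s)
∈-allSubsets (false Vec.∷ s) =
  ∈-cartesianProductWith⁺ Vec._∷_ {xs = true ∷ false ∷ []} (there (here refl)) (∈-allSubsets s)

allSubsets-unique : ∀ n → Unique (allSubsets n)
allSubsets-unique zero    = [] ∷ []
allSubsets-unique (suc n) = UniqueP.cartesianProductWith⁺ Vec._∷_ VecP.∷-injective
  (((λ ()) ∷ []) ∷ [] ∷ []) (allSubsets-unique n)

module _ {B : Set} (_≟_ : DecidableEquality B) where

  ∑-pick-∉ : ∀ {y : B} (xs : List B) → y ∉ xs → ∀ (g : B → ℚ) → ∑ xs (λ z → 𝟙 (y ≟ z) * g z) ≡ 0ℚ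
  ∑-pick-∉     []       _  g = refl
  ∑-pick-∉ {y} (x ∷ xs) y∉ g = begin
    𝟙 (y ≟ x) * g x + ∑ xs (λ z → 𝟙 (y ≟ z) * g z)
      ≡⟨ cong₂ _+_ (cong (_* g x) (𝟙-no (y ≟ x) (y∉ ∘ here))) (∑-pick-∉ xs (y∉ ∘ there) g) ⟩
    0ℚ * g x + 0ℚ
      ≡⟨ ≡.trans (ℚ.+-identityʳ _) (ℚ.*-zeroˡ (g x)) ⟩
    0ℚ ∎
    where open ≡-Reasoning

  ∑-pick : ∀ {xs : List B} → Unique xs → ∀ {y} → y ∈ xs →
           ∀ (g : B → ℚ) → ∑ xs (λ z → 𝟙 (y ≟ z) * g z) ≡ g y
  ∑-pick {x ∷ xs} (x∉ ∷ _) (here refl) g = begin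
    𝟙 (x ≟ x) * g x + ∑ xs (λ z → 𝟙 (x ≟ z) * g z)
      ≡⟨ cong₂ _+_ (cong (_* g x) (𝟙-yes (x ≟ x) refl)) (∑-pick-∉ xs (λ x∈ → All.lookup x∉ x∈ refl) g) ⟩
    1ℚ * g x + 0ℚ
      ≡⟨ ≡.trans (ℚ.+-identityʳ _) (ℚ.*-identityˡ (g x)) ⟩
    g x ∎
    where open ≡-Reasoning
  ∑-pick {x ∷ xs} (x∉ ∷ unique) {y} (there y∈) g = begin
    𝟙 (y ≟ x) * g x + ∑ xs (λ z → 𝟙 (y ≟ z) * g z)
      ≡⟨ cong₂ _+_ (cong (_* g x) (𝟙-no (y ≟ x) (All.lookup x∉ y∈ ∘ sym))) (∑-pick unique y∈ g) ⟩
    0ℚ * g x + g y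
      ≡⟨ ≡.trans (cong (_+ g y) (ℚ.*-zeroˡ (g x))) (ℚ.+-identityˡ (g y)) ⟩
    g y ∎
    where open ≡-Reasoning

  ∑-restrict : ∀ {xs ys : List B} → Unique xs → (∀ y → y ∈ xs) → Unique ys →
               ∀ (g : B → ℚ) → (∀ y → y ∉ ys → g y ≡ 0ℚ) → ∑ xs g ≡ ∑ ys g
  ∑-restrict {xs} {ys} xs-unique xs-complete ys-unique g g≡0 = begin
    ∑ xs g
      ≡⟨ IsLinear.resp (∑-linear xs) pick-ys ⟩
    ∑ xs (λ y → ∑ ys (λ z → 𝟙 (y ≟ z) * g z))
      ≡⟨ ∑-comm (∑-linear xs) ys (λ y z → 𝟙 (y ≟ z) * g z) ⟩
    ∑ ys (λ z → ∑ xs (λ y → 𝟙 (y ≟ z) * g z))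
      ≡⟨ IsLinear.resp (∑-linear ys) (λ z →
           ≡.trans (IsLinear.resp (∑-linear xs) (λ y → swap y z)) (∑-pick xs-unique (xs-complete z) g)) ⟩
    ∑ ys g ∎
    where
    open ≡-Reasoning
    pick-ys : ∀ y → g y ≡ ∑ ys (λ z → 𝟙 (y ≟ z) * g z)
    pick-ys y with DecMembership._∈?_ _≟_ y ys
    ... | yes y∈ = sym (∑-pick ys-unique y∈ g)
    ... | no  y∉ = ≡.trans (g≡0 y y∉) (sym (∑-pick-∉ ys y∉ g))
    swap : ∀ y z → 𝟙 (y ≟ z) * g z ≡ 𝟙 (z ≟ y) * g y
    swap y z with y ≟ z
    ... | yes refl = cong (_* g y) (sym (𝟙-yes (y ≟ y) refl))
    ... | no  y≢z  = ≡.trans (ℚ.*-zeroˡ (g z))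
                             (sym (≡.trans (cong (_* g y) (𝟙-no (z ≟ y) (y≢z ∘ sym))) (ℚ.*-zeroˡ (g y))))

module _ {n : ℕ} where

  Touches : Fin n → Pair n → Set
  Touches v (i , j) = i ≡ v ⊎ j ≡ v

  touches? : ∀ v → Decidable (Touches v)
  touches? v (i , j) = (i Fin.≟ v) ⊎-dec (j Fin.≟ v)

  crossing⇒bipartite : ∀ (s : Vec Bool n) {A} → All (Crossing s) A → Bipartite A
  crossing⇒bipartite s crosses e∈ e′∈ head≡tail with () ← ≡.trans (sym (proj₂ (All.lookup crosses e∈)))
    (≡.trans (cong (lookup s) head≡tail) (proj₁ (All.lookup crosses e′∈)))

  -- When A touches every vertex, the only candidate for L is the set of tails of A.
  ∑-crossing : ∀ A → (∀ v → Any (Touches v) A) →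
               ∑ (allSubsets n) (λ s → 𝟙 (all? (crossing? s) A)) ≡ 𝟙 (bipartite? A)
  ∑-crossing A touched = cases (bipartite? A)
    where
    cases : Dec (Bipartite A) → ∑ (allSubsets n) (λ s → 𝟙 (all? (crossing? s) A)) ≡ 𝟙 (bipartite? A)
    cases (no ¬bip) = ≡.trans
      (IsLinear.vanishes (∑-linear (allSubsets n)) (λ s → 𝟙-no (all? (crossing? s) A) (¬bip ∘ crossing⇒bipartite s)))
      (sym (𝟙-no (bipartite? A) ¬bip))
    cases (yes bip) = begin
      ∑ (allSubsets n) (λ s → 𝟙 (all? (crossing? s) A))
        ≡⟨ IsLinear.resp (∑-linear (allSubsets n)) (λ s →
             ≡.trans (𝟙-cong (all? (crossing? s) A) (s₀ ≟ s) (crossing⇔s₀ s)) (sym (ℚ.*-identityʳ _))) ⟩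
      ∑ (allSubsets n) (λ s → 𝟙 (s₀ ≟ s) * 1ℚ)
        ≡⟨ ∑-pick _≟_ (allSubsets-unique n) (∈-allSubsets s₀) (λ _ → 1ℚ) ⟩
      1ℚ
        ≡⟨ sym (𝟙-yes (bipartite? A) bip) ⟩
      𝟙 (bipartite? A) ∎
      where
      open ≡-Reasoning
      _≟_ = VecP.≡-dec Bool._≟_

      s₀ : Vec Bool n
      s₀ = Vec.tabulate (λ v → does (Any.any? ((Fin._≟ v) ∘ proj₁) A))

      tail : ∀ {e} → e ∈ A → lookup s₀ (proj₁ e) ≡ true
      tail {e} e∈ = ≡.trans (VecP.lookup∘tabulate _ (proj₁ e))
                            (dec-true (Any.any? _ A) (Any.map (cong proj₁ ∘ sym) e∈))

      head : ∀ {e} → e ∈ A → lookup s₀ (proj₂ e) ≡ false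
      head {e} e∈ = ≡.trans (VecP.lookup∘tabulate _ (proj₂ e)) (dec-false (Any.any? _ A) λ tail →
        let (e′ , e′∈ , e′-tail) = find tail in bip e∈ e′∈ (sym e′-tail))

      crossing⇔s₀ : ∀ s → All (Crossing s) A ⇔ s₀ ≡ s
      crossing⇔s₀ s = mk⇔
        (λ crosses → ≡.trans (VecP.tabulate-cong (λ v → ≡.trans (sym (VecP.lookup∘tabulate _ v)) (agree crosses v)))
                             (VecP.tabulate∘lookup s))
        (λ { refl → All.tabulate λ e∈ → tail e∈ , head e∈ })
        where
        agree : All (Crossing s) A → ∀ v → lookup s₀ v ≡ lookup s v
        agree crosses v with find (touched v)
        ... | e , e∈ , inj₁ refl = ≡.trans (tail e∈) (sym (proj₁ (All.lookup crosses e∈)))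
        ... | e , e∈ , inj₂ refl = ≡.trans (head e∈) (sym (proj₂ (All.lookup crosses e∈)))

-- Expansion of Greene's function

other-vertex : ∀ {n} → 2 ≤ n → (v : Fin n) → ∃ (_≢ v)
other-vertex (s≤s (s≤s _)) Fin.zero    = Fin.suc Fin.zero , λ ()
other-vertex (s≤s (s≤s _)) (Fin.suc _) = Fin.zero , λ ()

module Expansion {n : ℕ} (P : NLPoset n) (x : Fin n → ℚ) (x-injective : ∀ i j → x i ≡ x j → i ≡ j) where

  open Greene x x-injective

  Φ : List (Pair n) → ℚ
  Φ A = ∑perm (allFin n) (λ w → 𝟙 (all? (inversion? P w) A) * ψ w)

  Ψ≡∑perm-noInversion : ∀ Q →
    Ψ Q x ≡ ∑perm (allFin n) (λ w → 𝟙 (all? (¬? ∘ inversion? Q w) (allPairs n)) * ψ w)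
  Ψ≡∑perm-noInversion Q = ≡.trans (Ψ≡∑perm Q)
    (IsLinear.resp (∑perm-linear (allFin n)) (λ w → cong (_* ψ w) (𝟙-isLinExt Q w)))

  ∑perm-∑± : ∀ (c : List (Pair n) → ℚ) →
             ∑perm (allFin n) (λ w → ∑± (allPairs n) (λ A → c A * 𝟙 (all? (inversion? P w) A)) * ψ w) ≡
             ∑± (allPairs n) (λ A → c A * Φ A)
  ∑perm-∑± c = begin
    ∑perm (allFin n) (λ w → ∑± (allPairs n) (λ A → c A * 𝟙 (all? (inversion? P w) A)) * ψ w)
      ≡⟨ IsLinear.resp (∑perm-linear (allFin n)) (λ w → sym (IsLinear.*-homoʳ (∑±-linear (allPairs n)) _ (ψ w))) ⟩
    ∑perm (allFin n) (λ w → ∑± (allPairs n) (λ A → c A * 𝟙 (all? (inversion? P w) A) * ψ w))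
      ≡⟨ ∑±-comm (∑perm-linear (allFin n)) (allPairs n) _ ⟩
    ∑± (allPairs n) (λ A → ∑perm (allFin n) (λ w → c A * 𝟙 (all? (inversion? P w) A) * ψ w))
      ≡⟨ IsLinear.resp (∑±-linear (allPairs n)) (λ A → ≡.trans
           (IsLinear.resp (∑perm-linear (allFin n)) (λ w → ℚ.*-assoc (c A) _ (ψ w)))
           (IsLinear.*-homo (∑perm-linear (allFin n)) (c A) _)) ⟩
    ∑± (allPairs n) (λ A → c A * Φ A) ∎
    where open ≡-Reasoning

  linExt-expansion : ∀ {w} → Unique w →
    𝟙 (all? (¬? ∘ inversion? P w) (allPairs n)) ≡
    ∑± (allPairs n) (λ A → 𝟙 (bipartite? A) * 𝟙 (all? (inversion? P w) A))
  linExt-expansion {w} unique = begin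
    𝟙 (all? (¬? ∘ inversion? P w) (allPairs n))
      ≡⟨ sym (∑±-bipartite (inversion? P w) (λ {i} {j} → natural P i j ∘ proj₁) (Inversion-trans P unique)
                           (allPairs n) allPairs-sorted (λ _ _ _ _ → ∈-allPairs _)) ⟩
    ∑± (allPairs n) (λ A → 𝟙 (all? (inversion? P w) A ×-dec bipartite? A))
      ≡⟨ IsLinear.resp (∑±-linear (allPairs n)) (λ A →
           ≡.trans (𝟙-× (all? (inversion? P w) A) (bipartite? A))
                   (ℚ.*-comm (𝟙 (all? (inversion? P w) A)) (𝟙 (bipartite? A)))) ⟩
    ∑± (allPairs n) (λ A → 𝟙 (bipartite? A) * 𝟙 (all? (inversion? P w) A)) ∎
    where open ≡-Reasoning

  crossLinExt-expansion : ∀ s w →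
    𝟙 (all? (¬? ∘ inversion? (crossPoset P s) w) (allPairs n)) ≡
    ∑± (allPairs n) (λ A → 𝟙 (all? (crossing? s) A) * 𝟙 (all? (inversion? P w) A))
  crossLinExt-expansion s w = begin
    𝟙 (all? (¬? ∘ inversion? (crossPoset P s) w) (allPairs n))
      ≡⟨ 𝟙-cong (all? (¬? ∘ inversion? (crossPoset P s) w) (allPairs n)) (all? (¬? ∘ both?) (allPairs n))
                (All-cong (λ e → ¬-cong (Inversion-crossPoset P s w e))) ⟩
    𝟙 (all? (¬? ∘ both?) (allPairs n))
      ≡⟨ sym (∑±-all both? (allPairs n)) ⟩
    ∑± (allPairs n) (λ A → 𝟙 (all? both? A))
      ≡⟨ IsLinear.resp (∑±-linear (allPairs n)) (λ A → ≡.trans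
           (𝟙-cong (all? both? A) (all? (inversion? P w) A ×-dec all? (crossing? s) A) (mk⇔ All.unzip All.zip))
           (≡.trans (𝟙-× (all? (inversion? P w) A) (all? (crossing? s) A))
                    (ℚ.*-comm (𝟙 (all? (inversion? P w) A)) (𝟙 (all? (crossing? s) A))))) ⟩
    ∑± (allPairs n) (λ A → 𝟙 (all? (crossing? s) A) * 𝟙 (all? (inversion? P w) A)) ∎
    where
    open ≡-Reasoning
    both? : Decidable (λ e → Inversion P w e × Crossing s e)
    both? e = inversion? P w e ×-dec crossing? s e

  Ψ-expansion : Ψ P x ≡ ∑± (allPairs n) (λ A → 𝟙 (bipartite? A) * Φ A)
  Ψ-expansion = begin
    Ψ P x
      ≡⟨ Ψ≡∑perm-noInversion P ⟩
    ∑perm (allFin n) (λ w → 𝟙 (all? (¬? ∘ inversion? P w) (allPairs n)) * ψ w)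
      ≡⟨ ∑perm-cong↭ (allFin n) (λ w w↭ →
           cong (_* ψ w) (linExt-expansion (Unique-resp-↭ (↭-sym w↭) (allFin⁺ n)))) ⟩
    ∑perm (allFin n) (λ w → ∑± (allPairs n) (λ A → 𝟙 (bipartite? A) * 𝟙 (all? (inversion? P w) A)) * ψ w)
      ≡⟨ ∑perm-∑± (λ A → 𝟙 (bipartite? A)) ⟩
    ∑± (allPairs n) (λ A → 𝟙 (bipartite? A) * Φ A) ∎
    where open ≡-Reasoning

  ∑Ψ-expansion : ∑ (allSubsets n) (λ s → Ψ (crossPoset P s) x) ≡
                 ∑± (allPairs n) (λ A → ∑ (allSubsets n) (λ s → 𝟙 (all? (crossing? s) A)) * Φ A)
  ∑Ψ-expansion = begin
    ∑ (allSubsets n) (λ s → Ψ (crossPoset P s) x)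
      ≡⟨ IsLinear.resp (∑-linear (allSubsets n)) (λ s → begin
           Ψ (crossPoset P s) x
             ≡⟨ Ψ≡∑perm-noInversion (crossPoset P s) ⟩
           ∑perm (allFin n) (λ w → 𝟙 (all? (¬? ∘ inversion? (crossPoset P s) w) (allPairs n)) * ψ w)
             ≡⟨ IsLinear.resp (∑perm-linear (allFin n)) (λ w → cong (_* ψ w) (crossLinExt-expansion s w)) ⟩
           ∑perm (allFin n) (λ w →
             ∑± (allPairs n) (λ A → 𝟙 (all? (crossing? s) A) * 𝟙 (all? (inversion? P w) A)) * ψ w)
             ≡⟨ ∑perm-∑± (λ A → 𝟙 (all? (crossing? s) A)) ⟩
           ∑± (allPairs n) (λ A → 𝟙 (all? (crossing? s) A) * Φ A) ∎) ⟩
    ∑ (allSubsets n) (λ s → ∑± (allPairs n) (λ A → 𝟙 (all? (crossing? s) A) * Φ A))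
      ≡⟨ ∑±-comm (∑-linear (allSubsets n)) (allPairs n) _ ⟩
    ∑± (allPairs n) (λ A → ∑ (allSubsets n) (λ s → 𝟙 (all? (crossing? s) A) * Φ A))
      ≡⟨ IsLinear.resp (∑±-linear (allPairs n)) (λ A → IsLinear.*-homoʳ (∑-linear (allSubsets n)) _ (Φ A)) ⟩
    ∑± (allPairs n) (λ A → ∑ (allSubsets n) (λ s → 𝟙 (all? (crossing? s) A)) * Φ A) ∎
    where open ≡-Reasoning

  Φ-isolated : 2 ≤ n → ∀ {A v} → All (¬_ ∘ Touches v) A → Φ A ≡ 0ℚ
  Φ-isolated n≥2 {A} {v} isolated = ∑perm-ψ≡0 (Fin._≟ v) refl (proj₂ (other-vertex n≥2 v)) _ λ {w} {w′} same →
    𝟙-cong (all? (inversion? P w) A) (all? (inversion? P w′) A)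
           (mk⇔ (transfer same) (transfer (Product.map sym sym same)))
    where
    transfer : ∀ {w w′} → SameRestrictions (Fin._≟ v) w w′ → All (Inversion P w) A → All (Inversion P w′) A
    transfer same inversions = All.zipWith
      (λ ((i<j , ij) , avoids) → i<j , Equivalence.to (Inverted-cong (Fin._≟ v) same
         (mk⇔ (λ i≡v → contradiction (inj₁ i≡v) avoids) (λ j≡v → contradiction (inj₂ j≡v) avoids))) ij)
      (inversions , isolated)

  -- Sets A with an isolated vertex contribute nothing on either side; for the
  -- others, counting the crossing subsets gives exactly the bipartite ones.
  ∑Ψ-crossPoset : 2 ≤ n → ∑ (allSubsets n) (λ s → Ψ (crossPoset P s) x) ≡ Ψ P x
  ∑Ψ-crossPoset n≥2 = begin
    ∑ (allSubsets n) (λ s → Ψ (crossPoset P s) x)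
      ≡⟨ ∑Ψ-expansion ⟩
    ∑± (allPairs n) (λ A → ∑ (allSubsets n) (λ s → 𝟙 (all? (crossing? s) A)) * Φ A)
      ≡⟨ IsLinear.resp (∑±-linear (allPairs n)) coefficients ⟩
    ∑± (allPairs n) (λ A → 𝟙 (bipartite? A) * Φ A)
      ≡⟨ sym Ψ-expansion ⟩
    Ψ P x ∎
    where
    open ≡-Reasoning
    coefficients : ∀ A → ∑ (allSubsets n) (λ s → 𝟙 (all? (crossing? s) A)) * Φ A ≡ 𝟙 (bipartite? A) * Φ A
    coefficients A with FinP.any? (λ v → all? (¬? ∘ touches? v) A)
    ... | yes (v , isolated) = begin
      N * Φ A                 ≡⟨ cong (N *_) (Φ-isolated n≥2 isolated) ⟩
      N * 0ℚ                  ≡⟨ ℚ.*-zeroʳ N ⟩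
      0ℚ                      ≡⟨ sym (ℚ.*-zeroʳ (𝟙 (bipartite? A))) ⟩
      𝟙 (bipartite? A) * 0ℚ   ≡⟨ cong (𝟙 (bipartite? A) *_) (sym (Φ-isolated n≥2 isolated)) ⟩
      𝟙 (bipartite? A) * Φ A  ∎
      where N = ∑ (allSubsets n) (λ s → 𝟙 (all? (crossing? s) A))
    ... | no ¬isolated = cong (_* Φ A) (∑-crossing A touched)
      where
      touched : ∀ v → Any (Touches v) A
      touched v with Any.any? (touches? v) A
      ... | yes touches = touches
      ... | no ¬touches = contradiction (v , ¬Any⇒All¬ A ¬touches) ¬isolated

-- Connectivity

module _ {n : ℕ} {E : Fin n → Fin n → Set} where

  Reach-trans : ∀ {u v w} → Reach E u v → Reach E v w → Reach E u w
  Reach-trans uv here       = uv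
  Reach-trans uv (fwd vw e) = fwd (Reach-trans uv vw) e
  Reach-trans uv (bwd vw e) = bwd (Reach-trans uv vw) e

  Reach-sym : ∀ {u v} → Reach E u v → Reach E v u
  Reach-sym here       = here
  Reach-sym (fwd uv e) = Reach-trans (bwd here e) (Reach-sym uv)
  Reach-sym (bwd uv e) = Reach-trans (fwd here e) (Reach-sym uv)

  Cut : Set
  Cut = ∃ λ (R : Subset n) → ∃ (_∈ˢ R) × ∃ (_∉ˢ R) × (∀ {i j} → E i j → (i ∈ˢ R ⇔ j ∈ˢ R))

  -- Grow a set R of vertices reachable from r by one neighbour at a time.
  connected⊎cut-from : (∀ i j → Dec (E i j)) → ∀ r R → Acc _⊃_ R →
                       r ∈ˢ R → (∀ {v} → v ∈ˢ R → Reach E r v) → Connected E ⊎ Cut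
  connected⊎cut-from E? r R (acc larger) r∈R reach
    with FinP.any? (λ i → FinP.any? (λ j → (i ∈ˢ? R) ×-dec ¬? (j ∈ˢ? R) ×-dec (E? i j ⊎-dec E? j i)))
  ... | yes (i , j , i∈R , j∉R , edge) =
    connected⊎cut-from E? r (R ∪ ⁅ j ⁆) (larger R⊂R′) (SubsetP.p⊆p∪q ⁅ j ⁆ r∈R) reach′
    where
    R⊂R′ : R ⊂ˢ R ∪ ⁅ j ⁆
    R⊂R′ = SubsetP.p⊆p∪q ⁅ j ⁆ , j , SubsetP.x∈p∪q⁺ (inj₂ (SubsetP.x∈⁅x⁆ j)) , j∉R
    reach′ : ∀ {v} → v ∈ˢ R ∪ ⁅ j ⁆ → Reach E r v
    reach′ v∈ with SubsetP.x∈p∪q⁻ R ⁅ j ⁆ v∈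
    ... | inj₁ v∈R = reach v∈R
    ... | inj₂ v∈j rewrite SubsetP.x∈⁅y⁆⇒x≡y j v∈j = [ fwd (reach i∈R) , bwd (reach i∈R) ] edge
  ... | no noLeaving with FinP.all? (_∈ˢ? R)
  ...   | yes all = inj₁ (λ u v → Reach-trans (Reach-sym (reach (all u))) (reach (all v)))
  ...   | no ¬all = inj₂ (R , (r , r∈R) , FinP.¬∀⟶∃¬ n _ (_∈ˢ? R) ¬all , λ {i} {j} e →
            mk⇔ (stays i j (inj₁ e)) (stays j i (inj₂ e)))
    where
    stays : ∀ i j → E i j ⊎ E j i → i ∈ˢ R → j ∈ˢ R
    stays i j edge i∈R with j ∈ˢ? R
    ... | yes j∈R = j∈R
    ... | no  j∉R = contradiction (i , j , i∈R , j∉R , edge) noLeaving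

connected⊎cut : ∀ {n} {E : Fin n → Fin n → Set} → (∀ i j → Dec (E i j)) → Connected E ⊎ Cut {E = E}
connected⊎cut {zero}  E? = inj₁ (λ ())
connected⊎cut {suc n} E? = connected⊎cut-from E? Fin.zero ⁅ Fin.zero ⁆ (⊃-wellFounded _) (SubsetP.x∈⁅x⁆ Fin.zero)
  (λ v∈ → ≡.subst (Reach _ Fin.zero) (sym (SubsetP.x∈⁅y⁆⇒x≡y Fin.zero v∈)) here)

gEdge? : ∀ {n} (P : NLPoset n) s i j → Dec (GEdge P s i j)
gEdge? P s i j =
  (lt P i j Bool.≟ true) ×-dec (lookup s i Bool.≟ true) ×-dec (lookup s j Bool.≟ false) ×-dec (i Fin.<? j)

-- The two sides of a cut are not related in P_{L,R}, so Greene's summand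
-- sums to zero over the shuffles of their linear extensions.
Ψ-disconnected : ∀ {n} (P : NLPoset n) x → (∀ i j → x i ≡ x j → i ≡ j) →
                 ∀ s → ¬ Connected (GEdge P s) → Ψ (crossPoset P s) x ≡ 0ℚ
Ψ-disconnected P x x-injective s ¬connected with connected⊎cut (gEdge? P s)
... | inj₁ connected = contradiction connected ¬connected
... | inj₂ (R , (r , r∈R) , (v , v∉R) , closed) =
  ≡.trans (Ψ≡∑perm Q) (∑perm-ψ≡0 (_∈ˢ? R) r∈R v∉R _ λ {w} {w′} same →
    𝟙-cong (isLinExt Q w Bool.≟ true) (isLinExt Q w′ Bool.≟ true)
      (Eqv.trans (isLinExt-⇔ Q w) (Eqv.trans (mk⇔ (transfer same) (transfer (Product.map sym sym same)))
                                              (Eqv.sym (isLinExt-⇔ Q w′)))))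
  where
  open Greene x x-injective
  Q = crossPoset P s
  transfer : ∀ {w w′} → SameRestrictions (_∈ˢ? R) w w′ →
             (∀ i j → lt Q i j ≡ true → ¬ Inverted w i j) → (∀ i j → lt Q i j ≡ true → ¬ Inverted w′ i j)
  transfer same noInv i j i<j =
    noInv i j i<j ∘ Equivalence.from (Inverted-cong (_∈ˢ? R) same (closed (crossPoset⇒GEdge P s i<j)))

proposition2p1 : (n : ℕ) → 2 ≤ n → (P : NLPoset n) →
    Σ (Vec Bool n → NLPoset n) λ Q →
      (∀ s → Connected (GEdge P s) → ∀ i j → Cover (Q s) i j ⇔ GEdge P s i j)
      × (∀ (S : List (Vec Bool n)) → Unique S →
           (∀ s → (s ∈ S) ⇔ Connected (GEdge P s)) →
           ∀ (x : Fin n → ℚ) → (∀ i j → x i ≡ x j → i ≡ j) →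
           Ψ P x ≡ sumℚ (map (λ s → Ψ (Q s) x) S))
proposition2p1 n n≥2 P = crossPoset P , (λ s _ → cover⇔GEdge P s) , λ S S-unique S⇔connected x x-injective → begin
  Ψ P x
    ≡⟨ sym (Expansion.∑Ψ-crossPoset P x x-injective n≥2) ⟩
  ∑ (allSubsets n) (λ s → Ψ (crossPoset P s) x)
    ≡⟨ ∑-restrict (VecP.≡-dec Bool._≟_) (allSubsets-unique n) ∈-allSubsets S-unique (λ s → Ψ (crossPoset P s) x)
         (λ s s∉S → Ψ-disconnected P x x-injective s (s∉S ∘ Equivalence.from (S⇔connected s))) ⟩
  ∑ S (λ s → Ψ (crossPoset P s) x) ∎
  where open ≡-Reasoning
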